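{- For integers $n\ge1$ and $d,k,c$, let $R_{(n,n,1)}^d(k,c)$ be the number of standard Young tableaux of shape $(n,n,1)$ with exactly $d$ descents such that the last cell of the first row contains $k$ and the single cell of the third row contains $c$ (this is $0$ when no such tableau exists). Then $R_{(1,1,1)}^2(1,3)=1$, and for every $n\ge2$ and integers $d,k,c$ with $n\le k\le 2n$, $3\le c\le 2n+1$, $c\ne k$, $2\le d\le n+1$: $$R_{(n,n,1)}^d(k,c)=\begin{cases}\sum_{a<k}R_{(n-1,n-1,1)}^{d-1}(a,c), & k=2n;\\ \sum_{a<k}R_{(n-1,n-1,1)}^{d}(a,c-1), & c=k+1;\\ \sum_{a<k}R_{(n-1,n-1,1)}^{d-1}(a,c-2), & k=2n-1,\ c=2n+1;\\ R_{(n-1,n-1,1)}^{d}(k-1,c-2)+\sum_{a<k-1}R_{(n-1,n-1,1)}^{d-1}(a,c-2), & c=2n+1,\ k\notin\{2n-1,2n\};\\ R_{(n-1,n-1,1)}^{d}(k-1,c-1)+\sum_{a<k-1}R_{(n-1,n-1,1)}^{d-1}(a,c-1), & k+1<c<2n+1;\\ R_{(n-1,n-1,1)}^{d}(k-1,c)+\sum_{a<k-1}R_{(n-1,n-1,1)}^{d-1}(a,c), & c<k<2n,\end{cases}$$ where the sums range over all integers $a$ satisfying the indicated bound.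
   Context: For a partition $\lambda=(\lambda_1,\lambda_2,\dots)$ of $N$, a standard Young tableau of shape $\lambda$ is a filling of the Young diagram (left-justified rows of lengths $\lambda_1\ge\lambda_2\ge\cdots$, row 1 on top) by $1,\dots,N$, each used once, increasing along rows and down columns. An entry $i$ is a descent if $i+1$ lies in a row strictly below the row of $i$; the descent number is the number of descents. -}

module Defs where

open import Data.Nat using (ℕ; zero; suc; _+_; _*_; _∸_; _<ᵇ_; _≤ᵇ_; _≡ᵇ_)
open import Data.Bool using (Bool; true; false; _∧_; _∨_; not; if_then_else_)
open import Data.List using (List; []; _∷_; length; map; concat; concatMap; filter; upTo; zip)
open import Data.Nat.ListAction using (sum)
open import Data.Bool.ListAction using (all)
open import Data.Product using (_×_; _,_)
open import Relation.Nullary.Decidable using (yes; no)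
open import Data.Bool.Properties using (T?)

-- A partition λ is given by its list of row lengths (row 1 first).
-- A filling of λ is a list of rows (row 1 first), each row a list of
-- entries read left to right.  Entries are the numbers 1..N.

shape : List (List ℕ) → List ℕ
shape T = map length T

eqList : List ℕ → List ℕ → Bool
eqList [] [] = true
eqList (x ∷ xs) (y ∷ ys) = (x ≡ᵇ y) ∧ eqList xs ys
eqList _ _ = false

count : ℕ → List ℕ → ℕ
count x [] = 0
count x (y ∷ ys) = (if x ≡ᵇ y then 1 else 0) + count x ys

increasing : List ℕ → Bool
increasing [] = true
increasing (x ∷ []) = true
increasing (x ∷ y ∷ ys) = (x <ᵇ y) ∧ increasing (y ∷ ys)

columnsIncreasing : List (List ℕ) → Bool
columnsIncreasing [] = true
columnsIncreasing (r ∷ []) = true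
columnsIncreasing (r ∷ r′ ∷ rs) =
  (length r′ ≤ᵇ length r)
  ∧ all (λ { (a , b) → a <ᵇ b }) (zip r r′)
  ∧ columnsIncreasing (r′ ∷ rs)

oneTo : ℕ → List ℕ
oneTo N = map suc (upTo N)

isSYT : List ℕ → List (List ℕ) → Bool
isSYT λs T =
  eqList (shape T) λs
  ∧ (length (concat T) ≡ᵇ sum λs)
  ∧ all (λ i → count i (concat T) ≡ᵇ 1) (oneTo (sum λs))
  ∧ all increasing T
  ∧ columnsIncreasing T

-- index (0-based, row 1 ↦ 0) of the row of T containing x
rowOf : List (List ℕ) → ℕ → ℕ
rowOf [] x = 0
rowOf (r ∷ rs) x = if 0 <ᵇ count x r then 0 else suc (rowOf rs x)

isDescent : List (List ℕ) → ℕ → Bool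
isDescent T i = rowOf T i <ᵇ rowOf T (suc i)

descentNumber : List (List ℕ) → ℕ
descentNumber T = length (filter (λ i → T? (isDescent T i)) (oneTo (length (concat T) ∸ 1)))

words : List ℕ → ℕ → List (List ℕ)
words A zero = [] ∷ []
words A (suc l) = concatMap (λ a → map (a ∷_) (words A l)) A

fillings : List ℕ → List ℕ → List (List (List ℕ))
fillings A [] = [] ∷ []
fillings A (l ∷ ls) = concatMap (λ r → map (r ∷_) (fillings A ls)) (words A l)

SYTs : List ℕ → List (List (List ℕ))
SYTs λs = filter (λ T → T? (isSYT λs T)) (fillings (oneTo (sum λs)) λs)

-- the last cell of the first row (0 if the first row is empty / absent)
lastOf : List ℕ → ℕ
lastOf [] = 0
lastOf (x ∷ []) = x
lastOf (x ∷ y ∷ ys) = lastOf (y ∷ ys)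

lastOfFirstRow : List (List ℕ) → ℕ
lastOfFirstRow [] = 0
lastOfFirstRow (r ∷ _) = lastOf r

thirdRowCell : List (List ℕ) → ℕ
thirdRowCell (_ ∷ _ ∷ (x ∷ _) ∷ _) = x
thirdRowCell _ = 0

shapeNN1 : ℕ → List ℕ
shapeNN1 n = n ∷ n ∷ 1 ∷ []

R : ℕ → ℕ → ℕ → ℕ → ℕ
R n d k c = length (filter (λ T → T? ((descentNumber T ≡ᵇ d)
                                     ∧ (lastOfFirstRow T ≡ᵇ k)
                                     ∧ (thirdRowCell T ≡ᵇ c)))
                           (SYTs (shapeNN1 n)))

-- Σ_{a < b} f a   (a ranging over 0 … b-1; R vanishes at a = 0 and at
-- negative a, so this is the paper's sum over all integers a < b)
sumBelow : ℕ → (ℕ → ℕ) → ℕ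
sumBelow b f = sum (map f (upTo b))

-- Record a tableau T of shape (n,n,1) by its row word y₁ … y_{2n+1}, where y_i ∈ {0,1,2}
-- is the row of the entry i. T is standard iff y is a lattice word with n zeros, n ones
-- and one 2; the descents of T are the ascents y_i < y_{i+1}; the last cell of the first
-- row holds the position k of the last 0 and the third row holds the position c of the 2.
-- So R^d_{(n,n,1)}(k,c) counts the words accepted by a deterministic automaton.
--
-- Words for n and for n−1 whose first k−1 letters agree are counted by the same
-- automaton run, so each case of the recurrence only has to be checked after a common
-- prefix of length k−1. There the word for n continues with its last 0 at k followed
-- by ones and possibly the 2; deleting this 0 and one of the following ones gives the
-- word for n−1. The last 0 of the shorter word is then the last 0 of the prefix. If the
-- prefix ends in 0, that 0 sits at k−1 and takes over the ascent of the deleted one;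
-- otherwise it lies before k−1 and the number of descents drops by one.

module Submission where

open import Defs
open import Data.Nat using (ℕ; zero; suc; _+_; _*_; _∸_; _<ᵇ_; _≤ᵇ_; _≡ᵇ_; _≤_; _<_; z≤n; s≤s)
open import Data.Nat.Properties
open import Data.Nat.ListAction using (sum)
open import Data.Nat.ListAction.Properties using (sum-++)
open import Data.Nat.Tactic.RingSolver using (solve-∀)
open import Data.Bool using (Bool; true; false; _∧_; if_then_else_; T)
open import Data.Bool.Properties using (T?; ∧-assoc; ∧-identityʳ; ∧-zeroʳ)
open import Data.Bool.ListAction using () renaming (all to allB)
open import Data.List using
  (List; []; _∷_; length; map; filter; _++_; [_]; concat; concatMap; cartesianProductWith; upTo; applyUpTo; zip)
open import Data.List.Properties using
  (∷-injective; length-map; map-cong; ++-identityʳ; map-++; upTo-∷ʳ; map-applyUpTo; length-++; ++-assoc)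
open import Data.List.Membership.Propositional using (_∈_)
open import Data.List.Membership.Propositional.Properties using
  (∈-∃++; ∈-++⁻; ∈-++⁺ˡ; ∈-++⁺ʳ; ∈-map⁺; ∈-map⁻; ∈-filter⁺; ∈-filter⁻)
open import Data.List.Relation.Unary.Any using (here; there)
open import Data.List.Relation.Unary.All as All using (All; []; _∷_)
import Data.List.Relation.Unary.All.Properties as All
open import Data.List.Relation.Unary.AllPairs using ([]; _∷_)
open import Data.List.Relation.Unary.Unique.Propositional using (Unique)
import Data.List.Relation.Unary.Unique.Propositional.Properties as Unique
open import Data.Product using (_×_; _,_; proj₁; proj₂; ∃)
open import Data.Sum using (inj₁; inj₂)
open import Data.Empty using (⊥; ⊥-elim)
open import Data.Unit using (⊤; tt)
open import Relation.Nullary using (¬_; yes; no)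
open import Relation.Binary.PropositionalEquality hiding ([_])

-- Counting in finite lists

𝟙 : Bool → ℕ
𝟙 true = 1
𝟙 false = 0

T⇒≡true : ∀ {b} → T b → b ≡ true
T⇒≡true {true} _ = refl

≡true⇒T : ∀ {b} → b ≡ true → T b
≡true⇒T refl = _

¬T⇒≡false : ∀ {b} → ¬ T b → b ≡ false
¬T⇒≡false {true} h = ⊥-elim (h _)
¬T⇒≡false {false} _ = refl

T-∧ˡ : ∀ {a b} → T (a ∧ b) → T a
T-∧ˡ {true} _ = _

T-∧ʳ : ∀ {a b} → T (a ∧ b) → T b
T-∧ʳ {true} h = h

T-∧⁺ : ∀ {a b} → T a → T b → T (a ∧ b)
T-∧⁺ {true} _ h = h

𝟙-¬T : ∀ {b} → ¬ T b → 𝟙 b ≡ 0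
𝟙-¬T {b} h rewrite ¬T⇒≡false h = refl

𝟙-T : ∀ {b} → T b → 𝟙 b ≡ 1
𝟙-T {b} h rewrite T⇒≡true h = refl

𝟙-cong : ∀ {a b} → (T a → T b) → (T b → T a) → 𝟙 a ≡ 𝟙 b
𝟙-cong {true} {true} f g = refl
𝟙-cong {true} {false} f g = ⊥-elim (f _)
𝟙-cong {false} {true} f g = ⊥-elim (g _)
𝟙-cong {false} {false} f g = refl

countᵇ : {A : Set} → (A → Bool) → List A → ℕ
countᵇ p xs = length (filter (λ x → T? (p x)) xs)

countᵇ-++ : ∀ {A : Set} (f : A → Bool) xs ys → countᵇ f (xs ++ ys) ≡ countᵇ f xs + countᵇ f ys
countᵇ-++ f [] ys = refl
countᵇ-++ f (x ∷ xs) ys with f x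
... | true = cong suc (countᵇ-++ f xs ys)
... | false = countᵇ-++ f xs ys

countᵇ-map : ∀ {A B : Set} (f : B → Bool) (g : A → B) xs → countᵇ f (map g xs) ≡ countᵇ (λ w → f (g w)) xs
countᵇ-map f g [] = refl
countᵇ-map f g (x ∷ xs) with f (g x)
... | true = cong suc (countᵇ-map f g xs)
... | false = countᵇ-map f g xs

countᵇ-filter : ∀ {A : Set} (p q : A → Bool) xs → countᵇ q (filter (λ x → T? (p x)) xs) ≡ countᵇ (λ x → p x ∧ q x) xs
countᵇ-filter p q [] = refl
countᵇ-filter p q (x ∷ L) with p x
... | false = countᵇ-filter p q L
... | true with q x
...   | true = cong suc (countᵇ-filter p q L)
...   | false = countᵇ-filter p q L

concatMap≡cartesianProductWith : ∀ {A B C : Set} (h : A → B → C) As Bs → concatMap (λ a → map (h a) Bs) As ≡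
  cartesianProductWith h As Bs
concatMap≡cartesianProductWith h [] Bs = refl
concatMap≡cartesianProductWith h (a ∷ As) Bs = cong (map (h a) Bs ++_) (concatMap≡cartesianProductWith h As Bs)

concatMap-unique : ∀ {A B C : Set} (h : A → B → C) → (∀ {a a' b b'} → h a b ≡ h a' b' → a ≡ a' × b ≡ b') → ∀
  {As Bs} → Unique As → Unique Bs →
  Unique (concatMap (λ a → map (h a) Bs) As)
concatMap-unique h inj {As} {Bs} uA uB = subst Unique (sym (concatMap≡cartesianProductWith h As Bs))
  (Unique.cartesianProductWith⁺ h inj uA uB)

words-unique : ∀ {A} l → Unique A → Unique (words A l)
words-unique zero uA = [] ∷ []
words-unique (suc l) uA = concatMap-unique _∷_ ∷-injective uA (words-unique l uA)

fillings-unique : ∀ {A} ls → Unique A → Unique (fillings A ls)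
fillings-unique [] uA = [] ∷ []
fillings-unique (l ∷ ls) uA = concatMap-unique _∷_ ∷-injective (words-unique l uA) (fillings-unique ls uA)

∈-concatMap⁺ : ∀ {A B C : Set} (h : A → B → C) {As Bs a b} → a ∈ As → b ∈ Bs → h a b ∈ concatMap (λ a → map (h a) Bs) As
∈-concatMap⁺ h {a' ∷ As} {Bs} (here refl) pb = ∈-++⁺ˡ (∈-map⁺ (h a') pb)
∈-concatMap⁺ h {a' ∷ As} {Bs} (there pa) pb = ∈-++⁺ʳ (map (h a') Bs) (∈-concatMap⁺ h pa pb)

∈-concatMap⁻ : ∀ {A B C : Set} (h : A → B → C) As Bs {x} → x ∈ concatMap (λ a → map (h a) Bs) As → ∃ λ a → ∃ λ b →
  a ∈ As × b ∈ Bs × x ≡ h a b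
∈-concatMap⁻ h (a ∷ As) Bs p with ∈-++⁻ (map (h a) Bs) p
... | inj₁ q with ∈-map⁻ (h a) q
...   | b , pb , e = a , b , here refl , pb , e
∈-concatMap⁻ h (a ∷ As) Bs p | inj₂ q with ∈-concatMap⁻ h As Bs q
...   | a' , b , pa , pb , e = a' , b , there pa , pb , e

∈-words⁺ : ∀ {A} l w → length w ≡ l → All (_∈ A) w → w ∈ words A l
∈-words⁺ zero [] refl [] = here refl
∈-words⁺ (suc l) (x ∷ w) refl (px ∷ pws) = ∈-concatMap⁺ _∷_ px (∈-words⁺ l w refl pws)

∈-words⁻ : ∀ {A} l w → w ∈ words A l → length w ≡ l × All (_∈ A) w
∈-words⁻ zero w (here refl) = refl , []
∈-words⁻ {A} (suc l) w p with ∈-concatMap⁻ _∷_ A (words A l) p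
... | a , v , pa , pv , refl with ∈-words⁻ l v pv
...   | e , al = cong suc e , pa ∷ al

∈-fillings₃⁺ : ∀ {A} l1 l2 l3 r1 r2 r3 → r1 ∈ words A l1 → r2 ∈ words A l2 → r3 ∈ words A l3 →
  (r1 ∷ r2 ∷ r3 ∷ []) ∈ fillings A (l1 ∷ l2 ∷ l3 ∷ [])
∈-fillings₃⁺ l1 l2 l3 r1 r2 r3 p1 m2 p3 = ∈-concatMap⁺ _∷_ p1 (∈-concatMap⁺ _∷_ m2 (∈-concatMap⁺ _∷_ p3 (here refl)))

∈-fillings₃⁻ : ∀ {A} l1 l2 l3 T → T ∈ fillings A (l1 ∷ l2 ∷ l3 ∷ []) →
  ∃ λ r1 → ∃ λ r2 → ∃ λ r3 → T ≡ (r1 ∷ r2 ∷ r3 ∷ []) × r1 ∈ words A l1 × r2 ∈ words A l2 × r3 ∈ words A l3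
∈-fillings₃⁻ {A} l1 l2 l3 T p with ∈-concatMap⁻ _∷_ (words A l1) (fillings A (l2 ∷ l3 ∷ [])) p
... | r1 , T1 , p1 , q1 , refl with ∈-concatMap⁻ _∷_ (words A l2) (fillings A (l3 ∷ [])) q1
...   | r2 , T2 , m2 , q2 , refl with ∈-concatMap⁻ _∷_ (words A l3) (fillings A []) q2
...     | r3 , T3 , p3 , here refl , refl = r1 , r2 , r3 , refl , p1 , m2 , p3

length-≤-⊆ : ∀ {A : Set} (xs ys : List A) → Unique xs → (∀ {x} → x ∈ xs → x ∈ ys) → length xs ≤ length ys
length-≤-⊆ [] ys _ _ = z≤n
length-≤-⊆ (x ∷ xs) ys (px ∷ ux) h with ∈-∃++ (h (here refl))
... | ys1 , ys2 , refl = subst (suc (length xs) ≤_) (sym (trans (length-++ ys1) (+-suc (length ys1) (length ys2))))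
        (s≤s (subst (length xs ≤_) (length-++ ys1) (length-≤-⊆ xs (ys1 ++ ys2) ux h')))
  where
  h' : ∀ {w} → w ∈ xs → w ∈ ys1 ++ ys2
  h' {w} w∈ with ∈-++⁻ ys1 (h (there w∈))
  ... | inj₁ p = ∈-++⁺ˡ p
  ... | inj₂ (here refl) = ⊥-elim (All.lookup px w∈ refl)
  ... | inj₂ (there p) = ∈-++⁺ʳ ys1 p

map-unique : ∀ {A B : Set} (f : A → B) (xs : List A) → Unique xs → (∀ {x y} → x ∈ xs → y ∈ xs → f x ≡ f y → x ≡ y)
  → Unique (map f xs)
map-unique f [] _ _ = []
map-unique f (x ∷ xs) (px ∷ ux) inj = allm xs (λ y∈ → y∈) ∷ map-unique f xs ux (λ a b e → inj (there a) (there b) e)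
  where
  allm : ∀ zs → (∀ {w} → w ∈ zs → w ∈ xs) → All (λ v → f x ≢ v) (map f zs)
  allm [] _ = []
  allm (w ∷ zs) sub = (λ e → All.lookup px (sub (here refl)) (inj (here refl) (there (sub (here refl))) e)) ∷ allm
    zs (λ p → sub (there p))

count-≤-injection : ∀ {A B : Set} (L : List A) (M : List B) (P : A → Bool) (Q : B → Bool) (f : A → B)
  (g : B → A) → Unique L →
  (∀ x → x ∈ L → T (P x) → f x ∈ M × T (Q (f x)) × g (f x) ≡ x) →
  countᵇ P L ≤ countᵇ Q M
count-≤-injection L M P Q f g uL h = subst (_≤ length (filter (λ y → T? (Q y)) M)) (length-map f FL)
  (length-≤-⊆ (map f FL) (filter (λ y → T? (Q y)) M) (map-unique f FL (Unique.filter⁺ (λ x → T? (P x)) uL) inj) sub)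
  where
  FL = filter (λ x → T? (P x)) L
  mem : ∀ {x} → x ∈ FL → x ∈ L × T (P x)
  mem p = ∈-filter⁻ (λ x → T? (P x)) p
  inj : ∀ {x y} → x ∈ FL → y ∈ FL → f x ≡ f y → x ≡ y
  inj {x} {y} px py e = trans (sym (proj₂ (proj₂ (h x (proj₁ (mem px)) (proj₂ (mem px))))))
    (trans (cong g e) (proj₂ (proj₂ (h y (proj₁ (mem py)) (proj₂ (mem py))))))
  sub : ∀ {w} → w ∈ map f FL → w ∈ filter (λ y → T? (Q y)) M
  sub p with ∈-map⁻ f p
  ... | x , px , refl = let r = h x (proj₁ (mem px)) (proj₂ (mem px)) in ∈-filter⁺ (λ y → T? (Q y)) (proj₁ r)
                              (proj₁ (proj₂ r))

count-≡-bijection : ∀ {A B : Set} (L : List A) (M : List B) (P : A → Bool) (Q : B → Bool) (f : A → B) (g : B → A)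
  → Unique L → Unique M →
  (∀ x → x ∈ L → T (P x) → f x ∈ M × T (Q (f x)) × g (f x) ≡ x) →
  (∀ y → y ∈ M → T (Q y) → g y ∈ L × T (P (g y)) × f (g y) ≡ y) →
  countᵇ P L ≡ countᵇ Q M
count-≡-bijection L M P Q f g uL uM h1 h2 = ≤-antisym (count-≤-injection L M P Q f g uL h1)
  (count-≤-injection M L Q P g f uM h2)

sum-map-+ : ∀ (f g : ℕ → ℕ) L → sum (map (λ a → f a + g a) L) ≡ sum (map f L) + sum (map g L)
sum-map-+ f g [] = refl
sum-map-+ f g (x ∷ L) rewrite sum-map-+ f g L = +-sum (f x) (g x) (sum (map f L)) (sum (map g L))
  where
  +-sum : ∀ a b c e → a + b + (c + e) ≡ a + c + (b + e)
  +-sum = solve-∀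

sumBelow-+ : ∀ B (f g : ℕ → ℕ) → sumBelow B (λ a → f a + g a) ≡ sumBelow B f + sumBelow B g
sumBelow-+ B f g = sum-map-+ f g (upTo B)

sumBelow-cong : ∀ B (f g : ℕ → ℕ) → (∀ a → f a ≡ g a) → sumBelow B f ≡ sumBelow B g
sumBelow-cong B f g h = cong sum (map-cong h (upTo B))

sumBelow-suc : ∀ B f → sumBelow (suc B) f ≡ sumBelow B f + f B
sumBelow-suc B f = begin
    sum (map f (upTo (suc B)))
  ≡⟨ cong (λ L → sum (map f L)) (sym (upTo-∷ʳ B)) ⟩
    sum (map f (upTo B ++ [ B ]))
  ≡⟨ cong sum (map-++ f (upTo B) [ B ]) ⟩
    sum (map f (upTo B) ++ [ f B ])
  ≡⟨ sum-++ (map f (upTo B)) [ f B ] ⟩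
    sum (map f (upTo B)) + (f B + 0)
  ≡⟨ cong (sum (map f (upTo B)) +_) (+-identityʳ _) ⟩
    _ ∎
  where
  open ≡-Reasoning

sumBelow-zeros : ∀ B f → (∀ a → a < B → f a ≡ 0) → sumBelow B f ≡ 0
sumBelow-zeros zero f h = refl
sumBelow-zeros (suc B) f h rewrite sumBelow-suc B f | sumBelow-zeros B f (λ a lt → h a (m<n⇒m<1+n lt)) = h B ≤-refl

sumBelow-single : ∀ B v f → v < B → (∀ a → a < B → a ≢ v → f a ≡ 0) → sumBelow B f ≡ f v
sumBelow-single zero v f () h
sumBelow-single (suc B) v f lt h with v ≟ B
... | yes refl rewrite sumBelow-suc B f | sumBelow-zeros B f (λ a lt' → h a (m<n⇒m<1+n lt') (λ e → <⇒≢ lt' e)) = refl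
... | no ne rewrite sumBelow-suc B f | sumBelow-single B v f (≤∧≢⇒< (≤-pred lt) ne)
  (λ a lt' → h a (m<n⇒m<1+n lt')) | h B ≤-refl (λ e → ne (sym e)) = +-identityʳ _

-- An automaton reading row words

-- State after reading a prefix y₁ … y_{next−1}: the lengths of the three rows, the
-- row of the entry next − 1 (3 before the first letter, so that it is never part of
-- an ascent), the number of ascents so far, the entries ending rows 0 and 2 (0 if
-- empty), and whether no prefix has had a longer lower row (letters above 2 make
-- this false).
record State : Set where
  constructor state
  field
    next len₀ len₁ len₂ lastRow descents lastOf₀ lastOf₂ : ℕ
    lattice : Bool
open State public

place : State → ℕ → State
place s zero = state (suc (next s)) (suc (len₀ s)) (len₁ s) (len₂ s) 0 (𝟙 (lastRow s <ᵇ 0) + descents s) (next s)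
  (lastOf₂ s) (lattice s)
place s (suc zero) = state (suc (next s)) (len₀ s) (suc (len₁ s)) (len₂ s) 1 (𝟙 (lastRow s <ᵇ 1) + descents s)
  (lastOf₀ s) (lastOf₂ s) (lattice s ∧ (len₁ s <ᵇ len₀ s))
place s (suc (suc zero)) = state (suc (next s)) (len₀ s) (len₁ s) (suc (len₂ s)) 2
  (𝟙 (lastRow s <ᵇ 2) + descents s) (lastOf₀ s) (next s) (lattice s ∧ (len₂ s <ᵇ len₁ s))
place s (suc (suc (suc _))) = state (suc (next s)) (len₀ s) (len₁ s) (len₂ s) (lastRow s) (descents s) (lastOf₀ s)
  (lastOf₂ s) false

final : ℕ → ℕ → ℕ → ℕ → State → Bool
final n d k c s = (len₀ s ≡ᵇ n) ∧
  ((len₁ s ≡ᵇ n) ∧ ((len₂ s ≡ᵇ 1) ∧ ((descents s ≡ᵇ d) ∧ ((lastOf₀ s ≡ᵇ k) ∧ ((lastOf₂ s ≡ᵇ c) ∧ lattice s)))))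

accepts : ℕ → ℕ → ℕ → ℕ → State → List ℕ → Bool
accepts n d k c s [] = final n d k c s
accepts n d k c s (x ∷ w) = accepts n d k c (place s x) w

rowIndices : List ℕ
rowIndices = 0 ∷ 1 ∷ 2 ∷ []

completions : ℕ → ℕ → ℕ → ℕ → State → ℕ → ℕ
completions n d k c s m = countᵇ (accepts n d k c s) (words rowIndices m)

start : State
start = state 1 0 0 0 3 0 0 0 true

size : ℕ → ℕ
size n = sum (shapeNN1 n)

completions-suc : ∀ n d k c s m → completions n d k c s (suc m) ≡ completions n d k c (place s 0) m +
  (completions n d k c (place s 1) m + completions n d k c (place s 2) m)
completions-suc n d k c s m = begin
    countᵇ A (map (0 ∷_) W ++ (map (1 ∷_) W ++ (map (2 ∷_) W ++ [])))
  ≡⟨ countᵇ-++ A (map (0 ∷_) W) _ ⟩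
    countᵇ A (map (0 ∷_) W) + countᵇ A (map (1 ∷_) W ++ (map (2 ∷_) W ++ []))
  ≡⟨ cong (countᵇ A (map (0 ∷_) W) +_) (countᵇ-++ A (map (1 ∷_) W) _) ⟩
    countᵇ A (map (0 ∷_) W) + (countᵇ A (map (1 ∷_) W) + countᵇ A (map (2 ∷_) W ++ []))
  ≡⟨ cong₂ _+_ (countᵇ-map A (0 ∷_) W)
    (cong₂ _+_ (countᵇ-map A (1 ∷_) W)
    (trans (cong (countᵇ A) (++-identityʳ (map (2 ∷_) W))) (countᵇ-map A (2 ∷_) W))) ⟩
    _ ∎
  where
  open ≡-Reasoning
  W = words rowIndices m
  A = accepts n d k c s

completions-zero : ∀ n d k c s → completions n d k c s 0 ≡ 𝟙 (final n d k c s)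
completions-zero n d k c s with final n d k c s
... | true = refl
... | false = refl

record Final (n d k c : ℕ) (s : State) : Set where
  constructor mkFinal
  field
    final-len₀ : len₀ s ≡ n
    final-len₁ : len₁ s ≡ n
    final-len₂ : len₂ s ≡ 1
    final-descents : descents s ≡ d
    final-lastOf₀ : lastOf₀ s ≡ k
    final-lastOf₂ : lastOf₂ s ≡ c
    final-lattice : T (lattice s)
open Final public

T-final⇒Final : ∀ n d k c s → T (final n d k c s) → Final n d k c s
T-final⇒Final n d k c s h = mkFinal (≡ᵇ⇒≡ _ _ (T-∧ˡ {len₀ s ≡ᵇ n} h)) (≡ᵇ⇒≡ _ _ (T-∧ˡ {len₁ s ≡ᵇ n} h1))
  (≡ᵇ⇒≡ _ _ (T-∧ˡ {len₂ s ≡ᵇ 1} h2))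
  (≡ᵇ⇒≡ _ _ (T-∧ˡ {descents s ≡ᵇ d} h3)) (≡ᵇ⇒≡ _ _ (T-∧ˡ {lastOf₀ s ≡ᵇ k} h4))
  (≡ᵇ⇒≡ _ _ (T-∧ˡ {lastOf₂ s ≡ᵇ c} h5)) h6
  where
  h1 = T-∧ʳ {len₀ s ≡ᵇ n} h
  h2 = T-∧ʳ {len₁ s ≡ᵇ n} h1
  h3 = T-∧ʳ {len₂ s ≡ᵇ 1} h2
  h4 = T-∧ʳ {descents s ≡ᵇ d} h3
  h5 = T-∧ʳ {lastOf₀ s ≡ᵇ k} h4
  h6 = T-∧ʳ {lastOf₂ s ≡ᵇ c} h5

Final⇒T-final : ∀ n d k c s → Final n d k c s → T (final n d k c s)
Final⇒T-final n d k c s (mkFinal a b e f g h i) = T-∧⁺ (≡⇒≡ᵇ _ _ a) (T-∧⁺ (≡⇒≡ᵇ _ _ b) (T-∧⁺ (≡⇒≡ᵇ _ _ e)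
  (T-∧⁺ (≡⇒≡ᵇ _ _ f) (T-∧⁺ (≡⇒≡ᵇ _ _ g) (T-∧⁺ (≡⇒≡ᵇ _ _ h) i)))))

no-completions-zero : ∀ n d k c s → (Final n d k c s → ⊥) → completions n d k c s 0 ≡ 0
no-completions-zero n d k c s h = trans (completions-zero n d k c s) (𝟙-¬T (λ x → h (T-final⇒Final n d k c s x)))

-- Tableaux of shape (n,n,1) as row words

range : ℕ → ℕ → List ℕ
range s zero = []
range s (suc m) = s ∷ range (suc s) m

applyUpTo-range : ∀ (f : ℕ → ℕ) s m → (∀ i → f i ≡ s + i) → applyUpTo f m ≡ range s m
applyUpTo-range f s zero h = refl
applyUpTo-range f s (suc m) h = cong₂ _∷_ (trans (h 0) (+-identityʳ s))
  (applyUpTo-range (λ i → f (suc i)) (suc s) m (λ i → trans (h (suc i)) (+-suc s i)))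

oneTo≡range : ∀ N → oneTo N ≡ range 1 N
oneTo≡range N = trans (map-applyUpTo (λ i → i) suc N) (applyUpTo-range suc 1 N (λ i → refl))

∈-range⁺ : ∀ s m e → s ≤ e → e < s + m → e ∈ range s m
∈-range⁺ s zero e le lt = ⊥-elim (<-irrefl refl (≤-trans lt (≤-trans (≤-reflexive (+-identityʳ s)) le)))
∈-range⁺ s (suc m) e le lt with s ≟ e
... | yes refl = here refl
... | no ne = there (∈-range⁺ (suc s) m e (≤∧≢⇒< le ne) (subst (e <_) (+-suc s m) lt))

∈-range⁻ : ∀ s m e → e ∈ range s m → s ≤ e × e < s + m
∈-range⁻ s (suc m) e (here refl) = ≤-refl , subst (s <_) (sym (+-suc s m)) (s≤s (m≤m+n s m))
∈-range⁻ s (suc m) e (there p) with ∈-range⁻ (suc s) m e p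
... | le , lt = ≤-trans (n≤1+n s) le , subst (e <_) (sym (+-suc s m)) lt

positions : ℕ → ℕ → List ℕ → List ℕ
positions j s [] = []
positions j s (x ∷ y) = if j ≡ᵇ x then s ∷ positions j (suc s) y else positions j (suc s) y

tableauFrom : ℕ → List ℕ → List (List ℕ)
tableauFrom s y = positions 0 s y ∷ positions 1 s y ∷ positions 2 s y ∷ []

tableau : List ℕ → List (List ℕ)
tableau y = tableauFrom 1 y

rowWord : ℕ → List (List ℕ) → List ℕ
rowWord N Tb = map (rowOf Tb) (range 1 N)

≡ᵇ-refl : ∀ n → (n ≡ᵇ n) ≡ true
≡ᵇ-refl zero = refl
≡ᵇ-refl (suc n) = ≡ᵇ-refl n

≢⇒≡ᵇ-false : ∀ {m n} → m ≢ n → (m ≡ᵇ n) ≡ false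
≢⇒≡ᵇ-false {m} {n} ne = ¬T⇒≡false (λ h → ne (≡ᵇ⇒≡ m n h))

count-++ : ∀ i xs ys → count i (xs ++ ys) ≡ count i xs + count i ys
count-++ i [] ys = refl
count-++ i (x ∷ xs) ys rewrite count-++ i xs ys = sym (+-assoc (if i ≡ᵇ x then 1 else 0) (count i xs) (count i ys))

count-ne : ∀ i s r → i ≢ s → count i (s ∷ r) ≡ count i r
count-ne i s r ne rewrite ≢⇒≡ᵇ-false ne = refl

count-eq : ∀ s r → count s (s ∷ r) ≡ suc (count s r)
count-eq s r rewrite ≡ᵇ-refl s = refl

count-0 : ∀ i r → All (λ e → i ≢ e) r → count i r ≡ 0
count-0 i [] [] = refl
count-0 i (e ∷ r) (p ∷ ps) rewrite ≢⇒≡ᵇ-false p = count-0 i r ps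

positions-≥ : ∀ j s y → All (s ≤_) (positions j s y)
positions-≥ j s [] = []
positions-≥ j s (x ∷ y) with j ≡ᵇ x
... | true = ≤-refl ∷ All.map (λ le → ≤-trans (n≤1+n s) le) (positions-≥ j (suc s) y)
... | false = All.map (λ le → ≤-trans (n≤1+n s) le) (positions-≥ j (suc s) y)

positions-< : ∀ j s y → All (_< s + length y) (positions j s y)
positions-< j s [] = []
positions-< j s (x ∷ y) with j ≡ᵇ x
... | true = subst (s <_) (sym (+-suc s (length y))) (s≤s (m≤m+n s (length y))) ∷ All.map
  (λ {e} lt → subst (e <_) (sym (+-suc s (length y))) lt) (positions-< j (suc s) y)
... | false = All.map (λ {e} lt → subst (e <_) (sym (+-suc s (length y))) lt) (positions-< j (suc s) y)

length-positions : ∀ j s y → length (positions j s y) ≡ count j y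
length-positions j s [] = refl
length-positions j s (x ∷ y) with j ≡ᵇ x
... | true = cong suc (length-positions j (suc s) y)
... | false = length-positions j (suc s) y

count-positions-below : ∀ i j s y → i < s → count i (positions j s y) ≡ 0
count-positions-below i j s y lt = count-0 i _ (All.map (λ le e → <-irrefl e (<-≤-trans lt le)) (positions-≥ j s y))

Ternary : List ℕ → Set
Ternary = All (_≤ 2)

map-cong-range : ∀ (f g : ℕ → ℕ) s m → (∀ i → s ≤ i → f i ≡ g i) → map f (range s m) ≡ map g (range s m)
map-cong-range f g s zero h = refl
map-cong-range f g s (suc m) h = cong₂ _∷_ (h s ≤-refl)
  (map-cong-range f g (suc s) m (λ i le → h i (≤-trans (n≤1+n s) le)))

rowOf-cong : ∀ i r0 r1 r2 r0' r1' r2' → count i r0 ≡ count i r0' → count i r1 ≡ count i r1' → count i r2 ≡ count i r2' →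
  rowOf (r0 ∷ r1 ∷ r2 ∷ []) i ≡ rowOf (r0' ∷ r1' ∷ r2' ∷ []) i
rowOf-cong i r0 r1 r2 r0' r1' r2' e0 e1 e2 = cong₂ (λ a b → if 0 <ᵇ a then 0 else suc b) e0
  (cong₂ (λ a b → if 0 <ᵇ a then 0 else suc b) e1 (cong (λ a → if 0 <ᵇ a then 0 else 1) e2))

count-if-∷ : ∀ i s (b : Bool) r → i ≢ s → count i (if b then s ∷ r else r) ≡ count i r
count-if-∷ i s true r ne = count-ne i s r ne
count-if-∷ i s false r ne = refl

rowOf-tail : ∀ s x y i → suc s ≤ i → rowOf (tableauFrom s (x ∷ y)) i ≡ rowOf (tableauFrom (suc s) y) i
rowOf-tail s x y i le = rowOf-cong i (positions 0 s (x ∷ y)) (positions 1 s (x ∷ y)) (positions 2 s (x ∷ y))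
  (positions 0 (suc s) y) (positions 1 (suc s) y) (positions 2 (suc s) y)
  (count-if-∷ i s (0 ≡ᵇ x) (positions 0 (suc s) y) ne) (count-if-∷ i s (1 ≡ᵇ x) (positions 1 (suc s) y) ne)
  (count-if-∷ i s (2 ≡ᵇ x) (positions 2 (suc s) y) ne)
  where
  ne : i ≢ s
  ne e = <-irrefl (sym e) le

rowOf-head : ∀ s x y → x ≤ 2 → rowOf (tableauFrom s (x ∷ y)) s ≡ x
rowOf-head s zero y _ rewrite count-eq s (positions 0 (suc s) y) = refl
rowOf-head s (suc zero) y _ rewrite count-positions-below s 0 (suc s) y ≤-refl | count-eq s
  (positions 1 (suc s) y) = refl
rowOf-head s (suc (suc zero)) y _ rewrite count-positions-below s 0 (suc s) y ≤-refl | count-positions-below s 1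
  (suc s) y ≤-refl | count-eq s (positions 2 (suc s) y) = refl
rowOf-head s (suc (suc (suc x))) y (s≤s (s≤s ()))

rowWord-tableau : ∀ s y → Ternary y → map (rowOf (tableauFrom s y)) (range s (length y)) ≡ y
rowWord-tableau s [] [] = refl
rowWord-tableau s (x ∷ y) (px ∷ py) = cong₂ _∷_ (rowOf-head s x y px)
  (trans (map-cong-range _ _ (suc s) (length y) (λ i le → rowOf-tail s x y i le)) (rowWord-tableau (suc s) y py))

positions-map : ∀ j s m (h : ℕ → ℕ) → positions j s (map h (range s m)) ≡ filter (λ i → T? (j ≡ᵇ h i)) (range s m)
positions-map j s zero h = refl
positions-map j s (suc m) h with j ≡ᵇ h s
... | true = cong (s ∷_) (positions-map j (suc s) m h)
... | false = positions-map j (suc s) m h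

filter-cong-range : ∀ (p q : ℕ → Bool) s m → (∀ i → s ≤ i → i < s + m → p i ≡ q i) → filter (λ i → T? (p i))
  (range s m) ≡ filter (λ i → T? (q i)) (range s m)
filter-cong-range p q s zero h = refl
filter-cong-range p q s (suc m) h with p s | q s | h s ≤-refl (subst (s <_) (sym (+-suc s m)) (s≤s (m≤m+n s m)))
... | true | .true | refl = cong (s ∷_)
  (filter-cong-range p q (suc s) m (λ i le lt → h i (≤-trans (n≤1+n s) le) (subst (i <_) (sym (+-suc s m)) lt)))
... | false | .false | refl = filter-cong-range p q (suc s) m
  (λ i le lt → h i (≤-trans (n≤1+n s) le) (subst (i <_) (sym (+-suc s m)) lt))

rowAt : ℕ → List ℕ → List ℕ → List ℕ → List ℕ
rowAt zero r0 r1 r2 = r0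
rowAt (suc zero) r0 r1 r2 = r1
rowAt (suc (suc _)) r0 r1 r2 = r2

≡ᵇ-rowOf : ∀ j i r0 r1 r2 → j ≤ 2 → count i r0 + (count i r1 + (count i r2 + 0)) ≡ 1 →
  (j ≡ᵇ rowOf (r0 ∷ r1 ∷ r2 ∷ []) i) ≡ (0 <ᵇ count i (rowAt j r0 r1 r2))
≡ᵇ-rowOf zero i r0 r1 r2 jl e = row₀ (count i r0) (count i r1) (count i r2) e
  where
  row₀ : ∀ a b c → a + (b + (c + 0)) ≡ 1 →
    (0 ≡ᵇ (if 0 <ᵇ a then 0 else suc (if 0 <ᵇ b then 0 else suc (if 0 <ᵇ c then 0 else 1)))) ≡ (0 <ᵇ a)
  row₀ zero zero zero ()
  row₀ zero zero (suc c) e = refl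
  row₀ zero (suc b) c e = refl
  row₀ (suc a) b c e = refl
≡ᵇ-rowOf (suc zero) i r0 r1 r2 jl e = row₁ (count i r0) (count i r1) (count i r2) e
  where
  row₁ : ∀ a b c → a + (b + (c + 0)) ≡ 1 →
    (1 ≡ᵇ (if 0 <ᵇ a then 0 else suc (if 0 <ᵇ b then 0 else suc (if 0 <ᵇ c then 0 else 1)))) ≡ (0 <ᵇ b)
  row₁ zero zero zero ()
  row₁ zero zero (suc c) e = refl
  row₁ zero (suc b) c e = refl
  row₁ (suc a) zero c e = refl
  row₁ (suc zero) (suc b) c ()
  row₁ (suc (suc a)) (suc b) c ()
≡ᵇ-rowOf (suc (suc zero)) i r0 r1 r2 jl e = row₂ (count i r0) (count i r1) (count i r2) e
  where
  row₂ : ∀ a b c → a + (b + (c + 0)) ≡ 1 →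
    (2 ≡ᵇ (if 0 <ᵇ a then 0 else suc (if 0 <ᵇ b then 0 else suc (if 0 <ᵇ c then 0 else 1)))) ≡ (0 <ᵇ c)
  row₂ zero zero zero ()
  row₂ zero zero (suc c) e = refl
  row₂ zero (suc b) zero e = refl
  row₂ zero (suc zero) (suc c) ()
  row₂ zero (suc (suc b)) (suc c) ()
  row₂ (suc a) zero zero e = refl
  row₂ (suc zero) zero (suc c) ()
  row₂ (suc zero) (suc b) c ()
  row₂ (suc (suc a)) b c ()
≡ᵇ-rowOf (suc (suc (suc j))) i r0 r1 r2 (s≤s (s≤s ())) e

increasing⇒All : ∀ e r → T (increasing (e ∷ r)) → All (e <_) r × T (increasing r)
increasing⇒All e [] h = [] , _
increasing⇒All e (e' ∷ r) h with increasing⇒All e' r (T-∧ʳ {e <ᵇ e'} h)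
... | a , ir = (<ᵇ⇒< e e' (T-∧ˡ {e <ᵇ e'} h) ∷ All.map (λ lt → <-trans (<ᵇ⇒< e e' (T-∧ˡ {e <ᵇ e'} h)) lt) a) ,
  T-∧ʳ {e <ᵇ e'} h

shiftLt : ∀ {x} s m → x < s + suc m → x < suc s + m
shiftLt {x} s m lt = subst (x <_) (+-suc s m) lt

filter-count-range : ∀ s m r → T (increasing r) → All (λ e → s ≤ e × e < s + m) r → filter
  (λ i → T? (0 <ᵇ count i r)) (range s m) ≡ r
filter-count-range s zero [] _ _ = refl
filter-count-range s zero (e ∷ r) _ ((le , lt) ∷ _) = ⊥-elim
  (<-irrefl refl (≤-trans lt (≤-trans (≤-reflexive (+-identityʳ s)) le)))
filter-count-range s (suc m) [] _ _ = filter-count-range (suc s) m [] _ []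
filter-count-range s (suc m) (e ∷ r) ir ((le , lt) ∷ bs) with increasing⇒All e r ir | s ≟ e
... | ea , ir' | yes refl rewrite count-eq s r =
  cong (s ∷_) (trans (filter-cong-range _ _ (suc s) m
    (λ i le' lt' → cong (0 <ᵇ_) (count-ne i s r (λ e' → <-irrefl (sym e') le'))))
    (filter-count-range (suc s) m r ir' (All.zipWith (λ { (a , (le2 , lt2)) → a , shiftLt s m lt2 }) (ea , bs))))
... | ea , ir' | no ne rewrite count-0 s (e ∷ r)
  ((λ x → ne x) ∷ All.map (λ lt' x → <-irrefl x (<-trans (≤∧≢⇒< le ne) lt')) ea) =
  trans (filter-cong-range _ _ (suc s) m (λ i _ _ → refl))
  (filter-count-range (suc s) m (e ∷ r) ir
    ((≤∧≢⇒< le ne , subst (e <_) (+-suc s m) lt) ∷ All.zipWith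
    (λ { (a , (le2 , lt2)) → <-trans (≤∧≢⇒< le ne) a , shiftLt s m lt2 }) (ea , bs)))

tableau-rowWord : ∀ N r0 r1 r2 → T (increasing r0) → T (increasing r1) → T (increasing r2) →
  All (λ e → 1 ≤ e × e < 1 + N) r0 → All (λ e → 1 ≤ e × e < 1 + N) r1 → All (λ e → 1 ≤ e × e < 1 + N) r2 →
  (∀ i → 1 ≤ i → i < 1 + N → count i r0 + (count i r1 + (count i r2 + 0)) ≡ 1) →
  tableau (rowWord N (r0 ∷ r1 ∷ r2 ∷ [])) ≡ (r0 ∷ r1 ∷ r2 ∷ [])
tableau-rowWord N r0 r1 r2 inc₀ inc₁ inc₂ b0 b1 b2 hc = cong₂ _∷_ (comp 0 r0 z≤n refl inc₀ b0)
  (cong₂ _∷_ (comp 1 r1 (s≤s z≤n) refl inc₁ b1) (cong₂ _∷_ (comp 2 r2 ≤-refl refl inc₂ b2) refl))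
  where
  T3 = r0 ∷ r1 ∷ r2 ∷ []
  comp : ∀ j r → j ≤ 2 → rowAt j r0 r1 r2 ≡ r → T (increasing r) → All (λ e → 1 ≤ e × e < 1 + N) r → positions j 1
    (rowWord N T3) ≡ r
  comp j r jl es ir br = trans (positions-map j 1 N (rowOf T3))
    (trans (filter-cong-range _ _ 1 N
      (λ i le lt → trans (≡ᵇ-rowOf j i r0 r1 r2 jl (hc i le lt)) (cong (λ q → 0 <ᵇ count i q) es)))
    (filter-count-range 1 N r ir br))

run : State → List ℕ → State
run s [] = s
run s (x ∷ y) = run (place s x) y

accepts-run : ∀ n d k c s y → accepts n d k c s y ≡ final n d k c (run s y)
accepts-run n d k c s [] = refl
accepts-run n d k c s (x ∷ y) = accepts-run n d k c (place s x) y

lastOr : ℕ → List ℕ → ℕ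
lastOr d [] = d
lastOr d (x ∷ xs) = lastOr x xs

ascentsAfter : ℕ → List ℕ → ℕ
ascentsAfter p [] = 0
ascentsAfter p (x ∷ y) = 𝟙 (p <ᵇ x) + ascentsAfter x y

dominates : ℕ → ℕ → ℕ → ℕ → List ℕ → Bool
dominates a b ca cb [] = true
dominates a b ca cb (x ∷ y) = if x ≡ᵇ a then dominates a b (suc ca) cb y else
  (if x ≡ᵇ b then (cb <ᵇ ca) ∧ dominates a b ca (suc cb) y else dominates a b ca cb y)

len₀-run : ∀ s y → Ternary y → len₀ (run s y) ≡ count 0 y + len₀ s
len₀-run s [] [] = refl
len₀-run s (zero ∷ y) (_ ∷ py) = trans (len₀-run (place s 0) y py) (+-suc _ _)
len₀-run s (suc zero ∷ y) (_ ∷ py) = len₀-run (place s 1) y py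
len₀-run s (suc (suc zero) ∷ y) (_ ∷ py) = len₀-run (place s 2) y py
len₀-run s (suc (suc (suc x)) ∷ y) (s≤s (s≤s ()) ∷ py)

len₁-run : ∀ s y → Ternary y → len₁ (run s y) ≡ count 1 y + len₁ s
len₁-run s [] [] = refl
len₁-run s (zero ∷ y) (_ ∷ py) = len₁-run (place s 0) y py
len₁-run s (suc zero ∷ y) (_ ∷ py) = trans (len₁-run (place s 1) y py) (+-suc _ _)
len₁-run s (suc (suc zero) ∷ y) (_ ∷ py) = len₁-run (place s 2) y py
len₁-run s (suc (suc (suc x)) ∷ y) (s≤s (s≤s ()) ∷ py)

len₂-run : ∀ s y → Ternary y → len₂ (run s y) ≡ count 2 y + len₂ s
len₂-run s [] [] = refl
len₂-run s (zero ∷ y) (_ ∷ py) = len₂-run (place s 0) y py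
len₂-run s (suc zero ∷ y) (_ ∷ py) = len₂-run (place s 1) y py
len₂-run s (suc (suc zero) ∷ y) (_ ∷ py) = trans (len₂-run (place s 2) y py) (+-suc _ _)
len₂-run s (suc (suc (suc x)) ∷ y) (s≤s (s≤s ()) ∷ py)

descents-run : ∀ s y → Ternary y → descents (run s y) ≡ ascentsAfter (lastRow s) y + descents s
descents-run s [] [] = refl
descents-run s (x ∷ y) (px ∷ py) = run-dc' x px
  where
  ar : ∀ a b c → b + (a + c) ≡ a + b + c
  ar a b c = trans (sym (+-assoc b a c)) (cong (_+ c) (+-comm b a))
  run-dc' : ∀ x → x ≤ 2 → descents (run (place s x) y) ≡ 𝟙 (lastRow s <ᵇ x) + ascentsAfter x y + descents s
  run-dc' zero _ = trans (descents-run (place s 0) y py) (ar (𝟙 (lastRow s <ᵇ 0)) (ascentsAfter 0 y) (descents s))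
  run-dc' (suc zero) _ = trans (descents-run (place s 1) y py) (ar (𝟙 (lastRow s <ᵇ 1)) (ascentsAfter 1 y) (descents s))
  run-dc' (suc (suc zero)) _ = trans (descents-run (place s 2) y py)
    (ar (𝟙 (lastRow s <ᵇ 2)) (ascentsAfter 2 y) (descents s))
  run-dc' (suc (suc (suc x))) (s≤s (s≤s ()))

lastOf₀-run : ∀ s y → Ternary y → lastOf₀ (run s y) ≡ lastOr (lastOf₀ s) (positions 0 (next s) y)
lastOf₀-run s [] [] = refl
lastOf₀-run s (zero ∷ y) (_ ∷ py) = lastOf₀-run (place s 0) y py
lastOf₀-run s (suc zero ∷ y) (_ ∷ py) = lastOf₀-run (place s 1) y py
lastOf₀-run s (suc (suc zero) ∷ y) (_ ∷ py) = lastOf₀-run (place s 2) y py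
lastOf₀-run s (suc (suc (suc x)) ∷ y) (s≤s (s≤s ()) ∷ py)

lastOf₂-run : ∀ s y → Ternary y → lastOf₂ (run s y) ≡ lastOr (lastOf₂ s) (positions 2 (next s) y)
lastOf₂-run s [] [] = refl
lastOf₂-run s (zero ∷ y) (_ ∷ py) = lastOf₂-run (place s 0) y py
lastOf₂-run s (suc zero ∷ y) (_ ∷ py) = lastOf₂-run (place s 1) y py
lastOf₂-run s (suc (suc zero) ∷ y) (_ ∷ py) = lastOf₂-run (place s 2) y py
lastOf₂-run s (suc (suc (suc x)) ∷ y) (s≤s (s≤s ()) ∷ py)

lattice-run⇒ : ∀ s y → Ternary y → T (lattice (run s y)) → T (lattice s) × T (dominates 0 1 (len₀ s) (len₁ s) y) ×
  T (dominates 1 2 (len₁ s) (len₂ s) y)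
lattice-run⇒ s [] [] h = h , _ , _
lattice-run⇒ s (zero ∷ y) (_ ∷ py) h = lattice-run⇒ (place s 0) y py h
lattice-run⇒ s (suc zero ∷ y) (_ ∷ py) h with lattice-run⇒ (place s 1) y py h
... | a , b , c = T-∧ˡ {lattice s} a , T-∧⁺ {len₁ s <ᵇ len₀ s} (T-∧ʳ {lattice s} a) b , c
lattice-run⇒ s (suc (suc zero) ∷ y) (_ ∷ py) h with lattice-run⇒ (place s 2) y py h
... | a , b , c = T-∧ˡ {lattice s} a , b , T-∧⁺ {len₂ s <ᵇ len₁ s} (T-∧ʳ {lattice s} a) c
lattice-run⇒ s (suc (suc (suc x)) ∷ y) (s≤s (s≤s ()) ∷ py) h

lattice-run⇐ : ∀ s y → Ternary y → T (lattice s) → T (dominates 0 1 (len₀ s) (len₁ s) y) → T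
  (dominates 1 2 (len₁ s) (len₂ s) y) → T (lattice (run s y))
lattice-run⇐ s [] [] a b c = a
lattice-run⇐ s (zero ∷ y) (_ ∷ py) a b c = lattice-run⇐ (place s 0) y py a b c
lattice-run⇐ s (suc zero ∷ y) (_ ∷ py) a b c = lattice-run⇐ (place s 1) y py
  (T-∧⁺ {lattice s} a (T-∧ˡ {len₁ s <ᵇ len₀ s} b)) (T-∧ʳ {len₁ s <ᵇ len₀ s} b) c
lattice-run⇐ s (suc (suc zero) ∷ y) (_ ∷ py) a b c = lattice-run⇐ (place s 2) y py
  (T-∧⁺ {lattice s} a (T-∧ˡ {len₂ s <ᵇ len₁ s} c)) b (T-∧ʳ {len₂ s <ᵇ len₁ s} c)
lattice-run⇐ s (suc (suc (suc x)) ∷ y) (s≤s (s≤s ()) ∷ py) a b c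

ZipLt : List ℕ → List ℕ → Set
ZipLt r [] = ⊤
ZipLt [] (v ∷ r') = ⊤
ZipLt (u ∷ r) (v ∷ r') = u < v × ZipLt r r'

all-zip⇒ZipLt : ∀ (F : ℕ × ℕ → Bool) → (∀ u v → F (u , v) ≡ (u <ᵇ v)) → ∀ r r' → T (allB F (zip r r')) → ZipLt r r'
all-zip⇒ZipLt F hF [] [] h = tt
all-zip⇒ZipLt F hF [] (v ∷ r') h = tt
all-zip⇒ZipLt F hF (u ∷ r) [] h = tt
all-zip⇒ZipLt F hF (u ∷ r) (v ∷ r') h = <ᵇ⇒< u v (subst T (hF u v) (T-∧ˡ {F (u , v)} h)) , all-zip⇒ZipLt F hF r r'
  (T-∧ʳ {F (u , v)} h)

ZipLt⇒all-zip : ∀ (F : ℕ × ℕ → Bool) → (∀ u v → F (u , v) ≡ (u <ᵇ v)) → ∀ r r' → ZipLt r r' → T (allB F (zip r r'))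
ZipLt⇒all-zip F hF [] [] h = tt
ZipLt⇒all-zip F hF [] (v ∷ r') h = tt
ZipLt⇒all-zip F hF (u ∷ r) [] h = tt
ZipLt⇒all-zip F hF (u ∷ r) (v ∷ r') (lt , h) = T-∧⁺ {F (u , v)} (subst T (sym (hF u v)) (<⇒<ᵇ lt))
  (ZipLt⇒all-zip F hF r r' h)

positions-∷-≢ : ∀ j s x y → j ≢ x → positions j s (x ∷ y) ≡ positions j (suc s) y
positions-∷-≢ j s x y ne rewrite ≢⇒≡ᵇ-false ne = refl

positions-∷-≡ : ∀ j s y → positions j s (j ∷ y) ≡ s ∷ positions j (suc s) y
positions-∷-≡ j s y rewrite ≡ᵇ-refl j = refl

dominates-∷ˡ : ∀ a b ca cb y → dominates a b ca cb (a ∷ y) ≡ dominates a b (suc ca) cb y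
dominates-∷ˡ a b ca cb y rewrite ≡ᵇ-refl a = refl

dominates-∷ʳ : ∀ a b ca cb y → a ≢ b → dominates a b ca cb (b ∷ y) ≡ (cb <ᵇ ca) ∧ dominates a b ca (suc cb) y
dominates-∷ʳ a b ca cb y ne rewrite ≢⇒≡ᵇ-false {b} {a} (λ e → ne (sym e)) | ≡ᵇ-refl b = refl

dominates-∷-other : ∀ a b ca cb x y → x ≢ a → x ≢ b → dominates a b ca cb (x ∷ y) ≡ dominates a b ca cb y
dominates-∷-other a b ca cb x y na nb rewrite ≢⇒≡ᵇ-false na | ≢⇒≡ᵇ-false nb = refl

ZipLt-++-assoc : ∀ (q : List ℕ) s r1 r2 → ZipLt ((q ++ [ s ]) ++ r1) r2 → ZipLt (q ++ s ∷ r1) r2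
ZipLt-++-assoc q s r1 r2 h = subst (λ w → ZipLt w r2) (++-assoc q [ s ] r1) h

ZipLt-++-assoc⁻ : ∀ (q : List ℕ) s r1 r2 → ZipLt (q ++ s ∷ r1) r2 → ZipLt ((q ++ [ s ]) ++ r1) r2
ZipLt-++-assoc⁻ q s r1 r2 h = subst (λ w → ZipLt w r2) (sym (++-assoc q [ s ] r1)) h

dominates⇔ZipLt : ∀ a b → a ≢ b → ∀ y s (q : List ℕ) ca cb → All (_< s) q → length q + cb ≡ ca → count b y + cb ≤
  count a y + ca →
  (T (dominates a b ca cb y) → ZipLt (q ++ positions a s y) (positions b s y)) ×
    (ZipLt (q ++ positions a s y) (positions b s y) → T (dominates a b ca cb y))
dominates⇔ZipLt a b ab [] s q ca cb hq hl hc = (λ _ → tt) , (λ _ → _)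
dominates⇔ZipLt a b ab (x ∷ y) s q ca cb hq hl hc with x ≟ a
... | yes refl rewrite dominates-∷ˡ x b ca cb y | positions-∷-≡ x s y | positions-∷-≢ b s x y (λ e → ab (sym e)) =
  let r = dominates⇔ZipLt x b ab y (suc s) (q ++ [ s ]) (suc ca) cb hq' hl' hc' in
  (λ h → ZipLt-++-assoc q s _ _ (proj₁ r h)) , (λ h → proj₂ r (ZipLt-++-assoc⁻ q s _ _ h))
  where
  hq' : All (_< suc s) (q ++ [ s ])
  hq' = All.++⁺ (All.map (λ lt → m<n⇒m<1+n lt) hq) (≤-refl ∷ [])
  hl' : length (q ++ [ s ]) + cb ≡ suc ca
  hl' = trans (cong (_+ cb) (trans (length-++ q) (+-comm (length q) 1))) (cong suc hl)
  hc' : count b y + cb ≤ count x y + suc ca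
  hc' = subst₂ _≤_ (cong (_+ cb) (count-ne b x y (λ e → ab (sym e))))
    (trans (cong (_+ ca) (count-eq x y)) (sym (+-suc _ ca))) hc
... | no na with x ≟ b
... | yes refl rewrite dominates-∷ʳ a x ca cb y ab | positions-∷-≢ a s x y ab | positions-∷-≡ x s y = caseq q hq hl
  where
  hc' : count x y + suc cb ≤ count a y + ca
  hc' = subst₂ _≤_ (trans (cong (_+ cb) (count-eq x y)) (sym (+-suc _ cb))) (cong (_+ ca) (count-ne a x y ab)) hc
  caseq : ∀ q → All (_< s) q → length q + cb ≡ ca →
    (T ((cb <ᵇ ca) ∧ dominates a x ca (suc cb) y) → ZipLt (q ++ positions a (suc s) y) (s ∷ positions x (suc s) y)) ×
    (ZipLt (q ++ positions a (suc s) y) (s ∷ positions x (suc s) y) → T ((cb <ᵇ ca) ∧ dominates a x ca (suc cb) y))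
  caseq (q0 ∷ qt) (l0 ∷ lt) hl0 =
    let r = dominates⇔ZipLt a x ab y (suc s) qt ca (suc cb) (All.map (λ l → m<n⇒m<1+n l) lt)
          (trans (+-suc (length qt) cb) hl0) hc' in
    (λ h → l0 , proj₁ r (T-∧ʳ {cb <ᵇ ca} h)) ,
      (λ h → T-∧⁺ {cb <ᵇ ca} (<⇒<ᵇ (subst (cb <_) hl0 (s≤s (m≤n+m cb (length qt))))) (proj₂ r (proj₂ h)))
  caseq [] [] hl0 = (λ h → ⊥-elim (subst T (T⇒≡' (λ lt → <-irrefl hl0 lt)) (T-∧ˡ {cb <ᵇ ca} h))) ,
    (λ h → ⊥-elim (noAll h))
    where
    T⇒≡' : ¬ (cb < ca) → (cb <ᵇ ca) ≡ false
    T⇒≡' ne = ¬T⇒≡false (λ h → ne (<ᵇ⇒< cb ca h))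
    nz : 1 ≤ count a y
    nz = +-cancelʳ-≤ ca 1 (count a y)
      (≤-trans (s≤s (m≤n+m ca (count x y)))
      (subst (_≤ count a y + ca) (trans (+-suc (count x y) cb) (cong (λ w → suc (count x y + w)) hl0)) hc'))
    noAll : ZipLt (positions a (suc s) y) (s ∷ positions x (suc s) y) → ⊥
    noAll h with positions a (suc s) y | positions-≥ a (suc s) y | length-positions a (suc s) y
    ... | [] | _ | e = <-irrefl refl (≤-trans nz (≤-reflexive (sym e)))
    ... | p ∷ ps | ge ∷ _ | _ = <-irrefl refl (≤-trans (proj₁ h) (≤-trans (n≤1+n s) ge))
... | no nb rewrite dominates-∷-other a b ca cb x y na nb | positions-∷-≢ a s x y (λ e → na (sym e)) |
  positions-∷-≢ b s x y (λ e → nb (sym e)) =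
  dominates⇔ZipLt a b ab y (suc s) q ca cb (All.map (λ l → m<n⇒m<1+n l) hq) hl
    (subst₂ _≤_ (cong (_+ cb) (count-ne b x y (λ e → nb (sym e))))
      (cong (_+ ca) (count-ne a x y (λ e → na (sym e)))) hc)

dominates⇒count≤ : ∀ a b → a ≢ b → ∀ y ca cb → cb ≤ ca → T (dominates a b ca cb y) → count b y + cb ≤ count a y + ca
dominates⇒count≤ a b ab [] ca cb le h = le
dominates⇒count≤ a b ab (x ∷ y) ca cb le h with x ≟ a
... | yes refl rewrite dominates-∷ˡ x b ca cb y | count-eq x y | count-ne b x y (λ e → ab (sym e)) =
  subst (count b y + cb ≤_) (+-suc (count x y) ca) (dominates⇒count≤ x b ab y (suc ca) cb (m≤n⇒m≤1+n le) h)
... | no na with x ≟ b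
... | yes refl rewrite dominates-∷ʳ a x ca cb y ab | count-eq x y | count-ne a x y ab =
  subst (_≤ count a y + ca) (+-suc (count x y) cb)
    (dominates⇒count≤ a x ab y ca (suc cb) (<ᵇ⇒< cb ca (T-∧ˡ {cb <ᵇ ca} h)) (T-∧ʳ {cb <ᵇ ca} h))
... | no nb rewrite dominates-∷-other a b ca cb x y na nb | count-ne a x y (λ e → na (sym e)) | count-ne b x y
  (λ e → nb (sym e)) =
  dominates⇒count≤ a b ab y ca cb le h

dominates⇒ : ∀ a b → a ≢ b → ∀ y → T (dominates a b 0 0 y) → count b y ≤ count a y × ZipLt (positions a 1 y)
  (positions b 1 y)
dominates⇒ a b ab y h = cb , proj₁ (dominates⇔ZipLt a b ab y 1 [] 0 0 [] refl cb0) h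
  where
  cb0 : count b y + 0 ≤ count a y + 0
  cb0 = dominates⇒count≤ a b ab y 0 0 z≤n h
  cb : count b y ≤ count a y
  cb = subst₂ _≤_ (+-identityʳ _) (+-identityʳ _) cb0

dominates⇐ : ∀ a b → a ≢ b → ∀ y → count b y ≤ count a y → ZipLt (positions a 1 y) (positions b 1 y) → T
  (dominates a b 0 0 y)
dominates⇐ a b ab y le h = proj₂
  (dominates⇔ZipLt a b ab y 1 [] 0 0 [] refl (subst₂ _≤_ (sym (+-identityʳ _)) (sym (+-identityʳ _)) le)) h

allB⁺ : ∀ (p : ℕ → Bool) L → (∀ i → i ∈ L → T (p i)) → T (allB p L)
allB⁺ p [] h = tt
allB⁺ p (x ∷ L) h = T-∧⁺ {p x} (h x (here refl)) (allB⁺ p L (λ i m → h i (there m)))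

allB⁻ : ∀ (p : ℕ → Bool) L → T (allB p L) → ∀ i → i ∈ L → T (p i)
allB⁻ p (x ∷ L) h i (here refl) = T-∧ˡ {p x} h
allB⁻ p (x ∷ L) h i (there m) = allB⁻ p L (T-∧ʳ {p x} h) i m

positions-partition : ∀ s y → Ternary y → ∀ i → s ≤ i → i < s + length y → count i (positions 0 s y) +
  (count i (positions 1 s y) + (count i (positions 2 s y) + 0)) ≡ 1
positions-partition s [] [] i le lt = ⊥-elim (<-irrefl refl (≤-trans lt (≤-trans (≤-reflexive (+-identityʳ s)) le)))
positions-partition s (x ∷ y) (px ∷ py) i le lt with s ≟ i
... | no ne rewrite count-if-∷ i s (0 ≡ᵇ x) (positions 0 (suc s) y) (λ e → ne (sym e))
        | count-if-∷ i s (1 ≡ᵇ x) (positions 1 (suc s) y) (λ e → ne (sym e))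
        | count-if-∷ i s (2 ≡ᵇ x) (positions 2 (suc s) y) (λ e → ne (sym e)) = positions-partition (suc s) y py i
          (≤∧≢⇒< le ne) (subst (i <_) (+-suc s (length y)) lt)
... | yes refl = hd x px
  where
  c0 : ∀ j → count s (positions j (suc s) y) ≡ 0
  c0 j = count-positions-below s j (suc s) y ≤-refl
  hd : ∀ x → x ≤ 2 → count s (positions 0 s (x ∷ y)) +
    (count s (positions 1 s (x ∷ y)) + (count s (positions 2 s (x ∷ y)) + 0)) ≡ 1
  hd zero _ rewrite count-eq s (positions 0 (suc s) y) | c0 0 | c0 1 | c0 2 = refl
  hd (suc zero) _ rewrite count-eq s (positions 1 (suc s) y) | c0 0 | c0 1 | c0 2 = refl
  hd (suc (suc zero)) _ rewrite count-eq s (positions 2 (suc s) y) | c0 0 | c0 1 | c0 2 = refl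
  hd (suc (suc (suc x))) (s≤s (s≤s ()))

count-ternary : ∀ y → Ternary y → count 0 y + (count 1 y + (count 2 y + 0)) ≡ length y
count-ternary [] [] = refl
count-ternary (zero ∷ y) (_ ∷ py) = cong suc (count-ternary y py)
count-ternary (suc zero ∷ y) (_ ∷ py) = trans (+-suc (count 0 y) _) (cong suc (count-ternary y py))
count-ternary (suc (suc zero) ∷ y) (_ ∷ py) = trans (cong (count 0 y +_) (+-suc (count 1 y) _))
  (trans (+-suc (count 0 y) _) (cong suc (count-ternary y py)))
count-ternary (suc (suc (suc x)) ∷ y) (s≤s (s≤s ()) ∷ py)

increasing-∷ : ∀ s r → All (suc s ≤_) r → T (increasing r) → T (increasing (s ∷ r))
increasing-∷ s [] _ _ = tt
increasing-∷ s (e ∷ r) (le ∷ _) h = T-∧⁺ {s <ᵇ e} (<⇒<ᵇ le) h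

increasing-positions : ∀ j s y → T (increasing (positions j s y))
increasing-positions j s [] = tt
increasing-positions j s (x ∷ y) with j ≡ᵇ x
... | true = increasing-∷ s (positions j (suc s) y) (positions-≥ j (suc s) y) (increasing-positions j (suc s) y)
... | false = increasing-positions j (suc s) y

count-concat3 : ∀ i r0 r1 r2 → count i (concat (r0 ∷ r1 ∷ r2 ∷ [])) ≡ count i r0 + (count i r1 + (count i r2 + 0))
count-concat3 i r0 r1 r2 rewrite count-++ i r0 (r1 ++ (r2 ++ [])) | count-++ i r1 (r2 ++ []) | count-++ i r2 [] = refl

length-concat3 : ∀ (r0 r1 r2 : List ℕ) → length (concat (r0 ∷ r1 ∷ r2 ∷ [])) ≡ length r0 + (length r1 + (length r2 + 0))
length-concat3 r0 r1 r2 rewrite length-++ r0 {r1 ++ (r2 ++ [])} | length-++ r1 {r2 ++ []} | length-++ r2 {[]} = refl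

all-zip-∧⇒ : ∀ (F : ℕ × ℕ → Bool) → (∀ u v → F (u , v) ≡ (u <ᵇ v)) → ∀ r r' c → T (allB F (zip r r') ∧ c) →
  ZipLt r r' × T c
all-zip-∧⇒ F hF r r' c h = all-zip⇒ZipLt F hF r r' (T-∧ˡ {allB F (zip r r')} h) , T-∧ʳ {allB F (zip r r')} h

all-zip-∧⇐ : ∀ (F : ℕ × ℕ → Bool) → (∀ u v → F (u , v) ≡ (u <ᵇ v)) → ∀ r r' c → ZipLt r r' → T c → T
  (allB F (zip r r') ∧ c)
all-zip-∧⇐ F hF r r' c h hc = T-∧⁺ {allB F (zip r r')} (ZipLt⇒all-zip F hF r r' h) hc

columnsIncreasing⇒ : ∀ r0 r1 r2 → T (columnsIncreasing (r0 ∷ r1 ∷ r2 ∷ [])) → length r1 ≤ length r0 × ZipLt r0 r1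
  × length r2 ≤ length r1 × ZipLt r1 r2
columnsIncreasing⇒ r0 r1 r2 h = ≤ᵇ⇒≤ _ _ (T-∧ˡ {length r1 ≤ᵇ length r0} h) , proj₁ a1 ,
  ≤ᵇ⇒≤ _ _ (T-∧ˡ {length r2 ≤ᵇ length r1} (proj₂ a1)) , proj₁ a2
  where
  a1 = all-zip-∧⇒ _ (λ u v → refl) r0 r1 _ (T-∧ʳ {length r1 ≤ᵇ length r0} h)
  a2 = all-zip-∧⇒ _ (λ u v → refl) r1 r2 _ (T-∧ʳ {length r2 ≤ᵇ length r1} (proj₂ a1))

columnsIncreasing⇐ : ∀ r0 r1 r2 → length r1 ≤ length r0 → ZipLt r0 r1 → length r2 ≤ length r1 → ZipLt r1 r2 → T
  (columnsIncreasing (r0 ∷ r1 ∷ r2 ∷ []))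
columnsIncreasing⇐ r0 r1 r2 l1 a1 l2 a2 = T-∧⁺ {length r1 ≤ᵇ length r0} (≤⇒≤ᵇ l1)
  (all-zip-∧⇐ _ (λ u v → refl) r0 r1 _ a1
  (T-∧⁺ {length r2 ≤ᵇ length r1} (≤⇒≤ᵇ l2) (all-zip-∧⇐ _ (λ u v → refl) r1 r2 _ a2 tt)))

ascents-filter : ∀ (h : ℕ → ℕ) s m → length (filter (λ i → T? (h i <ᵇ h (suc i))) (range s m)) ≡ ascentsAfter
  (h s) (map h (range (suc s) m))
ascents-filter h s zero = refl
ascents-filter h s (suc m) with h s <ᵇ h (suc s)
... | true = cong suc (ascents-filter h (suc s) m)
... | false = ascents-filter h (suc s) m

length-tableau : ∀ y → Ternary y → length (concat (tableau y)) ≡ length y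
length-tableau y py = trans (length-concat3 (positions 0 1 y) (positions 1 1 y) (positions 2 1 y))
  (trans (cong₂ _+_ (length-positions 0 1 y)
    (cong₂ _+_ (length-positions 1 1 y) (cong (_+ 0) (length-positions 2 1 y)))) (count-ternary y py))

descentNumber-tableau : ∀ y → Ternary y → descentNumber (tableau y) ≡ ascentsAfter 3 y
descentNumber-tableau [] [] = refl
descentNumber-tableau (x ∷ y) (px ∷ py) = trans
  (cong (λ L → length (filter (λ i → T? (isDescent (tableau (x ∷ y)) i)) L))
  (trans (cong (λ m → oneTo (m ∸ 1)) (length-tableau (x ∷ y) (px ∷ py))) (oneTo≡range (length y))))
  (trans (ascents-filter (rowOf (tableau (x ∷ y))) 1 (length y))
    (trans (cong₂ ascentsAfter (proj₁ fg) (proj₂ fg)) (sym (d3 x px))))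
  where
  fg : rowOf (tableau (x ∷ y)) 1 ≡ x × map (rowOf (tableau (x ∷ y))) (range 2 (length y)) ≡ y
  fg = ∷-injective (rowWord-tableau 1 (x ∷ y) (px ∷ py))
  d3 : ∀ x → x ≤ 2 → ascentsAfter 3 (x ∷ y) ≡ ascentsAfter x y
  d3 zero _ = refl
  d3 (suc zero) _ = refl
  d3 (suc (suc zero)) _ = refl
  d3 (suc (suc (suc x))) (s≤s (s≤s ()))

lastOf-cons : ∀ x r → lastOf (x ∷ r) ≡ lastOr x r
lastOf-cons x [] = refl
lastOf-cons x (y ∷ r) = lastOf-cons y r

lastOfFirstRow-tableau : ∀ y → lastOfFirstRow (tableau y) ≡ lastOr 0 (positions 0 1 y)
lastOfFirstRow-tableau y with positions 0 1 y
... | [] = refl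
... | x ∷ r = lastOf-cons x r

thirdRowCell-tableau : ∀ y → length (positions 2 1 y) ≡ 1 → thirdRowCell (tableau y) ≡ lastOr 0 (positions 2 1 y)
thirdRowCell-tableau y e with positions 2 1 y
... | x ∷ [] = refl

counted : ℕ → ℕ → ℕ → ℕ → List (List ℕ) → Bool
counted n d k c Tb = isSYT (shapeNN1 n) Tb ∧
  ((descentNumber Tb ≡ᵇ d) ∧ (lastOfFirstRow Tb ≡ᵇ k) ∧ (thirdRowCell Tb ≡ᵇ c))

accepts⇒counted : ∀ n d k c y → Ternary y → length y ≡ size n → T (accepts n d k c start y) → T
  (counted n d k c (tableau y))
accepts⇒counted n d k c y py ly h = T-∧⁺ {isSYT (shapeNN1 n) (tableau y)} syt
    (T-∧⁺ {descentNumber (tableau y) ≡ᵇ d} (≡⇒≡ᵇ _ _ (trans (descentNumber-tableau y py) ed))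
      (T-∧⁺ {lastOfFirstRow (tableau y) ≡ᵇ k} (≡⇒≡ᵇ _ _ (trans (lastOfFirstRow-tableau y) ek))
        (≡⇒≡ᵇ _ _ (trans (thirdRowCell-tableau y (trans (length-positions 2 1 y) et)) ec))))
  where
  r0 = positions 0 1 y
  r1 = positions 1 1 y
  r2 = positions 2 1 y
  f = T-final⇒Final n d k c (run start y) (subst T (accepts-run n d k c start y) h)
  ez : count 0 y ≡ n
  ez = trans (sym (+-identityʳ _)) (trans (sym (len₀-run start y py)) (final-len₀ f))
  eo : count 1 y ≡ n
  eo = trans (sym (+-identityʳ _)) (trans (sym (len₁-run start y py)) (final-len₁ f))
  et : count 2 y ≡ 1
  et = trans (sym (+-identityʳ _)) (trans (sym (len₂-run start y py)) (final-len₂ f))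
  ed : ascentsAfter 3 y ≡ d
  ed = trans (sym (+-identityʳ _)) (trans (sym (descents-run start y py)) (final-descents f))
  ek : lastOr 0 r0 ≡ k
  ek = trans (sym (lastOf₀-run start y py)) (final-lastOf₀ f)
  ec : lastOr 0 r2 ≡ c
  ec = trans (sym (lastOf₂-run start y py)) (final-lastOf₂ f)
  oks = lattice-run⇒ start y py (final-lattice f)
  c01 = dominates⇒ 0 1 (λ ()) y (proj₁ (proj₂ oks))
  c12 = dominates⇒ 1 2 (λ ()) y (proj₂ (proj₂ oks))
  eql : T (eqList (shape (tableau y)) (shapeNN1 n))
  eql = T-∧⁺ {length r0 ≡ᵇ n} (≡⇒≡ᵇ _ _ (trans (length-positions 0 1 y) ez))
    (T-∧⁺ {length r1 ≡ᵇ n} (≡⇒≡ᵇ _ _ (trans (length-positions 1 1 y) eo))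
    (T-∧⁺ {length r2 ≡ᵇ 1} (≡⇒≡ᵇ _ _ (trans (length-positions 2 1 y) et)) tt))
  lc : T (length (concat (tableau y)) ≡ᵇ sum (shapeNN1 n))
  lc = ≡⇒≡ᵇ _ _ (trans (length-tableau y py) ly)
  ac : T (allB (λ i → count i (concat (tableau y)) ≡ᵇ 1) (oneTo (sum (shapeNN1 n))))
  ac = allB⁺ _ _ (λ i m → let b = ∈-range⁻ 1 (size n) i (subst (i ∈_) (oneTo≡range (size n)) m) in
        ≡⇒≡ᵇ _ _ (trans (count-concat3 i r0 r1 r2)
          (positions-partition 1 y py i (proj₁ b) (subst (λ w → i < 1 + w) (sym ly) (proj₂ b)))))
  ai : T (allB increasing (tableau y))
  ai = T-∧⁺ {increasing r0} (increasing-positions 0 1 y)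
    (T-∧⁺ {increasing r1} (increasing-positions 1 1 y) (T-∧⁺ {increasing r2} (increasing-positions 2 1 y) tt))
  ci : T (columnsIncreasing (tableau y))
  ci = columnsIncreasing⇐ r0 r1 r2
    (subst₂ _≤_ (sym (length-positions 1 1 y)) (sym (length-positions 0 1 y)) (proj₁ c01)) (proj₂ c01)
                     (subst₂ _≤_ (sym (length-positions 2 1 y)) (sym (length-positions 1 1 y)) (proj₁ c12)) (proj₂ c12)
  syt : T (isSYT (shapeNN1 n) (tableau y))
  syt = T-∧⁺ {eqList (shape (tableau y)) (shapeNN1 n)} eql (T-∧⁺ {length (concat (tableau y)) ≡ᵇ sum (shapeNN1 n)} lc
          (T-∧⁺ {allB (λ i → count i (concat (tableau y)) ≡ᵇ 1) (oneTo (sum (shapeNN1 n)))} ac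
            (T-∧⁺ {allB increasing (tableau y)} ai ci)))

counted⇒accepts : ∀ n d k c y → Ternary y → T (counted n d k c (tableau y)) → T (accepts n d k c start y)
counted⇒accepts n d k c y py h = subst T (sym (accepts-run n d k c start y)) (Final⇒T-final n d k c (run start y)
    (mkFinal (trans (len₀-run start y py) (trans (+-identityʳ _) ez))
      (trans (len₁-run start y py) (trans (+-identityʳ _) eo))
          (trans (len₂-run start y py) (trans (+-identityʳ _) et))
            (trans (descents-run start y py) (trans (+-identityʳ _) ed))
          (trans (lastOf₀-run start y py) ek) (trans (lastOf₂-run start y py) ec)
          (lattice-run⇐ start y py tt (dominates⇐ 0 1 (λ ()) y l01 (proj₁ (proj₂ cs)))
            (dominates⇐ 1 2 (λ ()) y l12 (proj₂ (proj₂ (proj₂ cs)))))))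
  where
  r0 = positions 0 1 y
  r1 = positions 1 1 y
  r2 = positions 2 1 y
  syt = T-∧ˡ {isSYT (shapeNN1 n) (tableau y)} h
  sts = T-∧ʳ {isSYT (shapeNN1 n) (tableau y)} h
  eql = T-∧ˡ {eqList (shape (tableau y)) (shapeNN1 n)} syt
  rest1 = T-∧ʳ {eqList (shape (tableau y)) (shapeNN1 n)} syt
  rest2 = T-∧ʳ {length (concat (tableau y)) ≡ᵇ sum (shapeNN1 n)} rest1
  rest3 = T-∧ʳ {allB (λ i → count i (concat (tableau y)) ≡ᵇ 1) (oneTo (sum (shapeNN1 n)))} rest2
  ci = T-∧ʳ {allB increasing (tableau y)} rest3
  cs = columnsIncreasing⇒ r0 r1 r2 ci
  ez : count 0 y ≡ n
  ez = trans (sym (length-positions 0 1 y)) (≡ᵇ⇒≡ _ _ (T-∧ˡ {length r0 ≡ᵇ n} eql))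
  eql1 = T-∧ʳ {length r0 ≡ᵇ n} eql
  eo : count 1 y ≡ n
  eo = trans (sym (length-positions 1 1 y)) (≡ᵇ⇒≡ _ _ (T-∧ˡ {length r1 ≡ᵇ n} eql1))
  eql2 = T-∧ʳ {length r1 ≡ᵇ n} eql1
  et : count 2 y ≡ 1
  et = trans (sym (length-positions 2 1 y)) (≡ᵇ⇒≡ _ _ (T-∧ˡ {length r2 ≡ᵇ 1} eql2))
  ed : ascentsAfter 3 y ≡ d
  ed = trans (sym (descentNumber-tableau y py)) (≡ᵇ⇒≡ _ _ (T-∧ˡ {descentNumber (tableau y) ≡ᵇ d} sts))
  sts1 = T-∧ʳ {descentNumber (tableau y) ≡ᵇ d} sts
  ek : lastOr 0 r0 ≡ k
  ek = trans (sym (lastOfFirstRow-tableau y)) (≡ᵇ⇒≡ _ _ (T-∧ˡ {lastOfFirstRow (tableau y) ≡ᵇ k} sts1))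
  ec : lastOr 0 r2 ≡ c
  ec = trans (sym (thirdRowCell-tableau y (trans (length-positions 2 1 y) et)))
    (≡ᵇ⇒≡ _ _ (T-∧ʳ {lastOfFirstRow (tableau y) ≡ᵇ k} sts1))
  l01 : count 1 y ≤ count 0 y
  l01 = subst₂ _≤_ (length-positions 1 1 y) (length-positions 0 1 y) (proj₁ cs)
  l12 : count 2 y ≤ count 1 y
  l12 = subst₂ _≤_ (length-positions 2 1 y) (length-positions 1 1 y) (proj₁ (proj₂ (proj₂ cs)))

-- R as a number of accepted words

rowIndices-unique : Unique rowIndices
rowIndices-unique = ((λ ()) ∷ (λ ()) ∷ []) ∷ ((λ ()) ∷ []) ∷ [] ∷ []

oneTo-unique : ∀ N → Unique (oneTo N)
oneTo-unique N = Unique.map⁺ suc-injective (Unique.upTo⁺ N)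

∈rowIndices⇒Ternary : ∀ {y} → All (_∈ rowIndices) y → Ternary y
∈rowIndices⇒Ternary = All.map f
  where
  f : ∀ {x} → x ∈ rowIndices → x ≤ 2
  f (here refl) = z≤n
  f (there (here refl)) = s≤s z≤n
  f (there (there (here refl))) = s≤s (s≤s z≤n)

Ternary⇒∈rowIndices : ∀ {y} → Ternary y → All (_∈ rowIndices) y
Ternary⇒∈rowIndices = All.map f
  where
  f : ∀ {x} → x ≤ 2 → x ∈ rowIndices
  f {zero} _ = here refl
  f {suc zero} _ = there (here refl)
  f {suc (suc zero)} _ = there (there (here refl))
  f {suc (suc (suc x))} (s≤s (s≤s ()))

rowOf≤2 : ∀ i r0 r1 r2 → count i r0 + (count i r1 + (count i r2 + 0)) ≡ 1 → rowOf (r0 ∷ r1 ∷ r2 ∷ []) i ≤ 2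
rowOf≤2 i r0 r1 r2 e = aux (count i r0) (count i r1) (count i r2) e
  where
  aux : ∀ a b c → a + (b + (c + 0)) ≡ 1 →
    (if 0 <ᵇ a then 0 else suc (if 0 <ᵇ b then 0 else suc (if 0 <ᵇ c then 0 else 1))) ≤ 2
  aux zero zero zero ()
  aux zero zero (suc c) e = s≤s (s≤s z≤n)
  aux zero (suc b) c e = s≤s z≤n
  aux (suc a) b c e = z≤n

length-range : ∀ s m → length (range s m) ≡ m
length-range s zero = refl
length-range s (suc m) = cong suc (length-range (suc s) m)

∈oneTo⇒bounds : ∀ N {r} → All (_∈ oneTo N) r → All (λ e → 1 ≤ e × e < 1 + N) r
∈oneTo⇒bounds N = All.map (λ m → ∈-range⁻ 1 N _ (subst (_ ∈_) (oneTo≡range N) m))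

R≡completions : ∀ n d k c → R n d k c ≡ completions n d k c start (size n)
R≡completions n d k c = trans (countᵇ-filter (isSYT λs) Pst F)
  (count-≡-bijection F (words rowIndices N) (counted n d k c) (accepts n d k c start) (rowWord N) tableau
                 (fillings-unique λs (oneTo-unique N)) (words-unique N rowIndices-unique) h1 h2)
  where
  λs = shapeNN1 n
  N = size n
  F = fillings (oneTo (sum λs)) λs
  Pst : List (List ℕ) → Bool
  Pst Tb = (descentNumber Tb ≡ᵇ d) ∧ (lastOfFirstRow Tb ≡ᵇ k) ∧ (thirdRowCell Tb ≡ᵇ c)
  h2 : ∀ y → y ∈ words rowIndices N → T (accepts n d k c start y) → tableau y ∈ F × T
    (counted n d k c (tableau y)) × rowWord N (tableau y) ≡ y
  h2 y my hy = mem , pt , subst (λ m → map (rowOf (tableauFrom 1 y)) (range 1 m) ≡ y) ly (rowWord-tableau 1 y py)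
    where
    wm = ∈-words⁻ N y my
    ly = proj₁ wm
    py = ∈rowIndices⇒Ternary (proj₂ wm)
    pt = accepts⇒counted n d k c y py ly hy
    eql = T-∧ˡ {eqList (shape (tableau y)) λs} (T-∧ˡ {isSYT λs (tableau y)} pt)
    l0 : length (positions 0 1 y) ≡ n
    l0 = ≡ᵇ⇒≡ _ _ (T-∧ˡ {length (positions 0 1 y) ≡ᵇ n} eql)
    l1 : length (positions 1 1 y) ≡ n
    l1 = ≡ᵇ⇒≡ _ _ (T-∧ˡ {length (positions 1 1 y) ≡ᵇ n} (T-∧ʳ {length (positions 0 1 y) ≡ᵇ n} eql))
    l2 : length (positions 2 1 y) ≡ 1
    l2 = ≡ᵇ⇒≡ _ _ (T-∧ˡ {length (positions 2 1 y) ≡ᵇ 1}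
      (T-∧ʳ {length (positions 1 1 y) ≡ᵇ n} (T-∧ʳ {length (positions 0 1 y) ≡ᵇ n} eql)))
    inr : ∀ j → All (_∈ oneTo N) (positions j 1 y)
    inr j = All.zipWith (λ { (a , b) → subst (_ ∈_) (sym (oneTo≡range N))
      (range-mem⁻' a (subst (λ m → _ < 1 + m) ly b)) }) (positions-≥ j 1 y , positions-< j 1 y)
      where
      range-mem⁻' : ∀ {e} → 1 ≤ e → e < 1 + N → e ∈ range 1 N
      range-mem⁻' {e} a b = ∈-range⁺ 1 N e a b
    mem : tableau y ∈ F
    mem = ∈-fillings₃⁺ n n 1 _ _ _ (∈-words⁺ n _ l0 (inr 0)) (∈-words⁺ n _ l1 (inr 1)) (∈-words⁺ 1 _ l2 (inr 2))
  h1 : ∀ Tb → Tb ∈ F → T (counted n d k c Tb) → rowWord N Tb ∈ words rowIndices N × T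
    (accepts n d k c start (rowWord N Tb)) × tableau (rowWord N Tb) ≡ Tb
  h1 Tb mT hT with ∈-fillings₃⁻ n n 1 Tb mT
  ... | r0 , r1 , r2 , refl , m0 , m1 , m2 = wmem , counted⇒accepts n d k c y py
    (subst (λ q → T (counted n d k c q)) (sym gf) hT) , gf
    where
    T3 = r0 ∷ r1 ∷ r2 ∷ []
    y = rowWord N T3
    syt = T-∧ˡ {isSYT λs T3} hT
    rest1 = T-∧ʳ {eqList (shape T3) λs} syt
    rest2 = T-∧ʳ {length (concat T3) ≡ᵇ sum λs} rest1
    ac = T-∧ˡ {allB (λ i → count i (concat T3) ≡ᵇ 1) (oneTo (sum λs))} rest2
    ai = T-∧ˡ {allB increasing T3} (T-∧ʳ {allB (λ i → count i (concat T3) ≡ᵇ 1) (oneTo (sum λs))} rest2)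
    hc : ∀ i → 1 ≤ i → i < 1 + N → count i r0 + (count i r1 + (count i r2 + 0)) ≡ 1
    hc i le lt = trans (sym (count-concat3 i r0 r1 r2))
      (≡ᵇ⇒≡ _ _ (allB⁻ _ (oneTo N) ac i (subst (i ∈_) (sym (oneTo≡range N)) (∈-range⁺ 1 N i le lt))))
    gf : tableau y ≡ T3
    gf = tableau-rowWord N r0 r1 r2 (T-∧ˡ {increasing r0} ai) (T-∧ˡ {increasing r1} (T-∧ʳ {increasing r0} ai))
      (T-∧ˡ {increasing r2} (T-∧ʳ {increasing r1} (T-∧ʳ {increasing r0} ai)))
           (∈oneTo⇒bounds N (proj₂ (∈-words⁻ n r0 m0))) (∈oneTo⇒bounds N (proj₂ (∈-words⁻ n r1 m1)))
             (∈oneTo⇒bounds N (proj₂ (∈-words⁻ 1 r2 m2))) hc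
    py : Ternary y
    py = pyg 1 N (λ i le lt → rowOf≤2 i r0 r1 r2 (hc i le lt))
      where
      pyg : ∀ s m → (∀ i → s ≤ i → i < s + m → rowOf T3 i ≤ 2) → Ternary (map (rowOf T3) (range s m))
      pyg s zero h = []
      pyg s (suc m) h = h s ≤-refl (subst (s <_) (sym (+-suc s m)) (s≤s (m≤m+n s m))) ∷ pyg (suc s) m
        (λ i le lt → h i (≤-trans (n≤1+n s) le) (subst (i <_) (sym (+-suc s m)) lt))
    wmem : y ∈ words rowIndices N
    wmem = ∈-words⁺ N y (trans (length-map (rowOf T3) (range 1 N)) (length-range 1 N)) (Ternary⇒∈rowIndices py)

-- Completions of a state

no-completions-len₀> : ∀ n d k c s m → n < len₀ s → completions n d k c s m ≡ 0
no-completions-len₀> n d k c s zero lt = no-completions-zero n d k c s (λ f → <⇒≢ lt (sym (final-len₀ f)))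
no-completions-len₀> n d k c s (suc m) lt rewrite completions-suc n d k c s m
  | no-completions-len₀> n d k c (place s 0) m (m<n⇒m<1+n lt)
  | no-completions-len₀> n d k c (place s 1) m lt
  | no-completions-len₀> n d k c (place s 2) m lt = refl

no-completions-len₂> : ∀ n d k c s m → 1 < len₂ s → completions n d k c s m ≡ 0
no-completions-len₂> n d k c s zero lt = no-completions-zero n d k c s (λ f → <⇒≢ lt (sym (final-len₂ f)))
no-completions-len₂> n d k c s (suc m) lt rewrite completions-suc n d k c s m
  | no-completions-len₂> n d k c (place s 0) m lt
  | no-completions-len₂> n d k c (place s 1) m lt
  | no-completions-len₂> n d k c (place s 2) m (m<n⇒m<1+n lt) = refl

no-completions-after-k : ∀ n d k c s m → k < next s → (lastOf₀ s ≡ k → len₀ s ≡ n → ⊥) → completions n d k c s m ≡ 0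
no-completions-after-k n d k c s zero lt h = no-completions-zero n d k c s (λ f → h (final-lastOf₀ f) (final-len₀ f))
no-completions-after-k n d k c s (suc m) lt h rewrite completions-suc n d k c s m
  | no-completions-after-k n d k c (place s 0) m (m<n⇒m<1+n lt) (λ e _ → <⇒≢ lt (sym e))
  | no-completions-after-k n d k c (place s 1) m (m<n⇒m<1+n lt) h
  | no-completions-after-k n d k c (place s 2) m (m<n⇒m<1+n lt) h = refl

no-completions-after-c : ∀ n d k c s m → c < next s → (lastOf₂ s ≡ c → len₂ s ≡ 1 → ⊥) → completions n d k c s m ≡ 0
no-completions-after-c n d k c s zero lt h = no-completions-zero n d k c s (λ f → h (final-lastOf₂ f) (final-len₂ f))
no-completions-after-c n d k c s (suc m) lt h rewrite completions-suc n d k c s m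
  | no-completions-after-c n d k c (place s 0) m (m<n⇒m<1+n lt) h
  | no-completions-after-c n d k c (place s 1) m (m<n⇒m<1+n lt) h
  | no-completions-after-c n d k c (place s 2) m (m<n⇒m<1+n lt) (λ e _ → <⇒≢ lt (sym e)) = refl

no-completions-two-misplaced : ∀ n d k c s m → len₂ s ≡ 1 → (lastOf₂ s ≡ c → ⊥) → completions n d k c s m ≡ 0
no-completions-two-misplaced n d k c s zero e h = no-completions-zero n d k c s (λ f → h (final-lastOf₂ f))
no-completions-two-misplaced n d k c s (suc m) e h rewrite completions-suc n d k c s m
  | no-completions-two-misplaced n d k c (place s 0) m e h
  | no-completions-two-misplaced n d k c (place s 1) m e h
  | no-completions-len₂> n d k c (place s 2) m (subst (λ x → 1 < suc x) (sym e) ≤-refl) = refl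

placeOnes : ℕ → State → State
placeOnes zero s = s
placeOnes (suc m) s = placeOnes m (place s 1)

placeOnes-closed : ℕ → State → State
placeOnes-closed m s = state (suc (m + next s)) (len₀ s) (suc (m + len₁ s)) (len₂ s) 1
  (𝟙 (lastRow s <ᵇ 1) + descents s) (lastOf₀ s) (lastOf₂ s) (lattice s ∧ (m + len₁ s <ᵇ len₀ s))

<ᵇ-∧ : ∀ x y w → x ≤ y → (x <ᵇ w) ∧ (y <ᵇ w) ≡ (y <ᵇ w)
<ᵇ-∧ x y w le with y <ᵇ w in eq
... | true = trans (∧-identityʳ _) (T⇒≡true (<⇒<ᵇ (≤-<-trans le (<ᵇ⇒< y w (≡true⇒T eq)))))
... | false = ∧-zeroʳ (x <ᵇ w)

placeOnes-suc : ∀ m s → placeOnes (suc m) s ≡ placeOnes-closed m s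
placeOnes-suc zero s = refl
placeOnes-suc (suc m) s = trans (placeOnes-suc m (place s 1))
  (trans (cong₂ (λ x y → state (suc x) (len₀ s) (suc y) (len₂ s) 1 (𝟙 (lastRow s <ᵇ 1) + descents s) (lastOf₀ s)
  (lastOf₂ s) (b2 y)) (+-suc m (next s)) (+-suc m (len₁ s)))
   (cong (state (suc (suc (m + next s))) (len₀ s) (suc (suc (m + len₁ s))) (len₂ s) 1
     (𝟙 (lastRow s <ᵇ 1) + descents s) (lastOf₀ s) (lastOf₂ s))
     (trans (∧-assoc (lattice s) _ _)
       (cong (lattice s ∧_) (<ᵇ-∧ (len₁ s) (suc (m + len₁ s)) (len₀ s) (m≤n+m (len₁ s) (suc m)))))))
  where
  b2 : ℕ → Bool
  b2 y = (lattice s ∧ (len₁ s <ᵇ len₀ s)) ∧ (y <ᵇ len₀ s)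

m≢m+1+n : ∀ m {n} → m ≢ m + suc n
m≢m+1+n m e = <⇒≢ (m<m+n m (s≤s z≤n)) e

completions-ones : ∀ n d k c s m → len₀ s ≡ n → len₂ s ≡ 1 → completions n d k c s m ≡ 𝟙 (final n d k c (placeOnes m s))
completions-ones n d k c s zero ez et = completions-zero n d k c s
completions-ones n d k c s (suc m) ez et rewrite completions-suc n d k c s m
  | no-completions-len₀> n d k c (place s 0) m (subst (λ x → x < suc (len₀ s)) ez ≤-refl)
  | no-completions-len₂> n d k c (place s 2) m (subst (λ x → 1 < suc x) (sym et) ≤-refl)
  | completions-ones n d k c (place s 1) m ez et = +-identityʳ _

completions-ones-two : ∀ n d k c j r s → len₀ s ≡ n → len₂ s ≡ 0 → next s + j ≡ c → completions n d k c s
  (j + suc r) ≡ completions n d k c (place (placeOnes j s) 2) r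
completions-ones-two n d k c zero r s ez et ep rewrite completions-suc n d k c s r
  | no-completions-len₀> n d k c (place s 0) r (subst (λ x → x < suc (len₀ s)) ez ≤-refl)
  | no-completions-after-c n d k c (place s 1) r
    (subst (λ x → x < suc (next s)) (trans (sym (+-identityʳ _)) ep) ≤-refl) (λ _ e → 0≢1+n (trans (sym et) e)) = refl
completions-ones-two n d k c (suc j) r s ez et ep rewrite completions-suc n d k c s (j + suc r)
  | no-completions-len₀> n d k c (place s 0) (j + suc r) (subst (λ x → x < suc (len₀ s)) ez ≤-refl)
  | no-completions-two-misplaced n d k c (place s 2) (j + suc r) (cong suc et)
    (λ e → m≢m+1+n (next s) (trans e (sym ep)))
  | completions-ones-two n d k c j r (place s 1) ez et (trans (sym (+-suc (next s) j)) ep) = +-identityʳ _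

Stepping : (State → ℕ → ℕ) → Set
Stepping H = ∀ s m → H s (suc m) ≡ H (place s 0) m + (H (place s 1) m + H (place s 2) m)

stepping-prefix : (P : State → Set) → (∀ s → P s → P (place s 0)) → (∀ s → P s → P (place s 1)) →
  (∀ s → P s → P (place s 2)) →
  (H1 H2 : State → ℕ → ℕ) → Stepping H1 → Stepping H2 → (K a b : ℕ) →
  (∀ s → P s → next s ≡ K → H1 s a ≡ H2 s b) →
  ∀ j s → P s → next s + j ≡ K → H1 s (j + a) ≡ H2 s (j + b)
stepping-prefix P P₀ P₁ P₂ H1 H2 s1 s2 K a b base zero s iv ep = base s iv (trans (sym (+-identityʳ _)) ep)
stepping-prefix P P₀ P₁ P₂ H1 H2 s1 s2 K a b base (suc j) s iv ep =
  trans (s1 s (j + a)) (trans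
    (cong₂ _+_ (rec (place s 0) (P₀ s iv) refl)
    (cong₂ _+_ (rec (place s 1) (P₁ s iv) refl) (rec (place s 2) (P₂ s iv) refl))) (sym (s2 s (j + b))))
  where
  rec : ∀ s' → P s' → next s' ≡ suc (next s) → H1 s' (j + a) ≡ H2 s' (j + b)
  rec s' iv' e = stepping-prefix P P₀ P₁ P₂ H1 H2 s1 s2 K a b base j s' iv'
    (trans (cong (_+ j) e) (trans (sym (+-suc (next s) j)) ep))

stepping-+ : ∀ H1 H2 → Stepping H1 → Stepping H2 → Stepping (λ s m → H1 s m + H2 s m)
stepping-+ H1 H2 s1 s2 s m rewrite s1 s m | s2 s m = sh (H1 (place s 0) m) (H1 (place s 1) m) (H1 (place s 2) m)
  (H2 (place s 0) m) (H2 (place s 1) m) (H2 (place s 2) m)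
  where
  sh : ∀ a b c a' b' c' → a + (b + c) + (a' + (b' + c')) ≡ a + a' + (b + b' + (c + c'))
  sh = solve-∀

stepping-sumBelow : ∀ B (H : ℕ → State → ℕ → ℕ) → (∀ a → Stepping (H a)) → Stepping (λ s m → sumBelow B (λ a → H a s m))
stepping-sumBelow B H sH s m = begin
    sumBelow B (λ a → H a s (suc m))
  ≡⟨ sumBelow-cong B _ _ (λ a → sH a s m) ⟩
    sumBelow B (λ a → H a (place s 0) m + (H a (place s 1) m + H a (place s 2) m))
  ≡⟨ sumBelow-+ B _ _ ⟩
    _ + sumBelow B (λ a → H a (place s 1) m + H a (place s 2) m)
  ≡⟨ cong (sumBelow B (λ a → H a (place s 0) m) +_) (sumBelow-+ B _ _) ⟩
    _ ∎
  where open ≡-Reasoning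

record Reachable (s : State) : Set where
  constructor mkReachable
  field
    lastOf₀<next : lastOf₀ s < next s
    lastRow≡0⇒lastOf₀-adjacent : lastRow s ≡ 0 → suc (lastOf₀ s) ≡ next s
    lastRow≢0⇒lastOf₀-not-adjacent : 2 ≤ next s → lastRow s ≢ 0 → suc (lastOf₀ s) ≢ next s
    lastRow≤2 : 2 ≤ next s → lastRow s ≤ 2
    no-two⇒lastRow≢2 : len₂ s ≡ 0 → lastRow s ≢ 2
    lastOf₂<next : lastOf₂ s < next s
    lattice⇒len₁≤len₀ : T (lattice s) → len₁ s ≤ len₀ s
open Reachable public

reachable-start : Reachable start
reachable-start = mkReachable (s≤s z≤n) (λ ()) (λ { (s≤s ()) }) (λ { (s≤s ()) }) (λ _ ()) (s≤s z≤n) (λ _ → z≤n)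

reachable-place₀ : ∀ s → Reachable s → Reachable (place s 0)
reachable-place₀ s iv = mkReachable ≤-refl (λ _ → refl) (λ _ h → ⊥-elim (h refl)) (λ _ → z≤n) (λ _ ())
  (m<n⇒m<1+n (lastOf₂<next iv)) (λ h → m≤n⇒m≤1+n (lattice⇒len₁≤len₀ iv h))

reachable-place₁ : ∀ s → Reachable s → Reachable (place s 1)
reachable-place₁ s iv = mkReachable (m<n⇒m<1+n (lastOf₀<next iv)) (λ ())
  (λ _ _ e → <⇒≢ (lastOf₀<next iv) (suc-injective e)) (λ _ → s≤s z≤n) (λ _ ()) (m<n⇒m<1+n (lastOf₂<next iv))
  (λ h → <ᵇ⇒< (len₁ s) (len₀ s) (T-∧ʳ {lattice s} h))

reachable-place₂ : ∀ s → Reachable s → Reachable (place s 2)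
reachable-place₂ s iv = mkReachable (m<n⇒m<1+n (lastOf₀<next iv)) (λ ())
  (λ _ _ e → <⇒≢ (lastOf₀<next iv) (suc-injective e)) (λ _ → ≤-refl) (λ ()) ≤-refl
  (λ h → lattice⇒len₁≤len₀ iv (T-∧ˡ {lattice s} h))

completions-at-k : ∀ n d k c s M → Reachable s → next s ≡ k → completions n d k c s (suc M) ≡ completions n d k
  c (place s 0) M
completions-at-k n d k c s M iv ep rewrite completions-suc n d k c s M
  | no-completions-after-k n d k c (place s 1) M (subst (λ x → x < suc (next s)) ep ≤-refl)
    (λ e _ → <⇒≢ (lastOf₀<next iv) (trans e (sym ep)))
  | no-completions-after-k n d k c (place s 2) M (subst (λ x → x < suc (next s)) ep ≤-refl)
    (λ e _ → <⇒≢ (lastOf₀<next iv) (trans e (sym ep))) = +-identityʳ _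

completions-at-k-len₀ : ∀ n' d k c s M → next s ≡ k → len₀ s ≢ n' → completions (suc n') d k c (place s 0) M ≡ 0
completions-at-k-len₀ n' d k c s M ep ne = no-completions-after-k (suc n') d k c (place s 0) M
  (subst (λ x → x < suc (next s)) ep ≤-refl) (λ _ e → ne (suc-injective e))

lastOf₀<k∸1 : ∀ s k' → Reachable s → next s ≡ suc (suc k') → lastRow s ≢ 0 → lastOf₀ s < suc k'
lastOf₀<k∸1 s k' iv ep ne = ≤∧≢⇒< (≤-pred (subst (lastOf₀ s <_) ep (lastOf₀<next iv)))
  (λ e → lastRow≢0⇒lastOf₀-not-adjacent iv (subst (2 ≤_) (sym ep) (s≤s (s≤s z≤n))) ne (trans (cong suc e) (sym ep)))

split-after-zero : ∀ k'' s (X : ℕ) (Y : ℕ → ℕ) → Reachable s → next s ≡ suc (suc k'') → lastRow s ≡ 0 →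
  (∀ a → a < suc k'' → lastOf₀ s ≢ a → Y a ≡ 0) → X + sumBelow (suc k'') Y ≡ X
split-after-zero k'' s X Y iv ep e0 hY rewrite sumBelow-zeros (suc k'') Y
  (λ a lt → hY a lt (λ e → <⇒≢ lt
  (suc-injective (trans (sym (cong suc e)) (trans (lastRow≡0⇒lastOf₀-adjacent iv e0) ep))))) = +-identityʳ X

split-after-nonzero : ∀ k'' s (X : ℕ) (Y : ℕ → ℕ) → Reachable s → next s ≡ suc (suc k'') → lastRow s ≢ 0 →
  (lastOf₀ s ≢ suc k'' → X ≡ 0) → (∀ a → a < suc k'' → lastOf₀ s ≢ a → Y a ≡ 0) → X + sumBelow (suc k'') Y
    ≡ Y (lastOf₀ s)
split-after-nonzero k'' s X Y iv ep ne hX hY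
  rewrite hX (<⇒≢ (lastOf₀<k∸1 s k'' iv ep ne))
  | sumBelow-single (suc k'') (lastOf₀ s) Y (lastOf₀<k∸1 s k'' iv ep ne) (λ a lt e → hY a lt (λ e' → e (sym e'))) = refl

sumBelow-at-lastOf₀ : ∀ k s (Y : ℕ → ℕ) → Reachable s → next s ≡ k → (∀ a → a < k → lastOf₀ s ≢ a → Y a ≡ 0) →
  sumBelow k Y ≡ Y (lastOf₀ s)
sumBelow-at-lastOf₀ k s Y iv ep hY = sumBelow-single k (lastOf₀ s) Y (subst (lastOf₀ s <_) ep (lastOf₀<next iv))
  (λ a lt e → hY a lt (λ e' → e (sym e')))

descentsOfOnes : ℕ → ℕ → ℕ
descentsOfOnes p zero = 0
descentsOfOnes p (suc m) = 𝟙 (p <ᵇ 1)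

lastRowOfOnes : ℕ → ℕ → ℕ
lastRowOfOnes p zero = p
lastRowOfOnes p (suc m) = 1

placeOnes′ : ℕ → State → State
placeOnes′ m s = state (m + next s) (len₀ s) (m + len₁ s) (len₂ s) (lastRowOfOnes (lastRow s) m)
  (descentsOfOnes (lastRow s) m + descents s) (lastOf₀ s) (lastOf₂ s) (lattice s)

descentsOfOnes-after-two : ∀ m → descentsOfOnes 2 m ≡ 0
descentsOfOnes-after-two zero = refl
descentsOfOnes-after-two (suc m) = refl

placeOnes≡placeOnes′ : ∀ m s → m + len₁ s ≤ len₀ s → placeOnes m s ≡ placeOnes′ m s
placeOnes≡placeOnes′ zero s le = refl
placeOnes≡placeOnes′ (suc m) s le = trans (placeOnes-suc m s)
  (cong (state (suc (m + next s)) (len₀ s) (suc (m + len₁ s)) (len₂ s) 1 (𝟙 (lastRow s <ᵇ 1) + descents s)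
  (lastOf₀ s) (lastOf₂ s))
  (trans (cong (lattice s ∧_) (T⇒≡true (<⇒<ᵇ le))) (∧-identityʳ (lattice s))))

len₁-placeOnes : ∀ m s → len₁ (placeOnes m s) ≡ m + len₁ s
len₁-placeOnes zero s = refl
len₁-placeOnes (suc m) s = trans (len₁-placeOnes m (place s 1)) (+-suc m (len₁ s))

no-completions-len₁> : ∀ n d k c s m → n < len₁ s → completions n d k c s m ≡ 0
no-completions-len₁> n d k c s zero lt = no-completions-zero n d k c s (λ f → <⇒≢ lt (sym (final-len₁ f)))
no-completions-len₁> n d k c s (suc m) lt rewrite completions-suc n d k c s m
  | no-completions-len₁> n d k c (place s 0) m lt
  | no-completions-len₁> n d k c (place s 1) m (m<n⇒m<1+n lt)
  | no-completions-len₁> n d k c (place s 2) m lt = refl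

completions-ones′ : ∀ n d k c s m → len₀ s ≡ n → len₂ s ≡ 1 → completions n d k c s m ≡ 𝟙
  (final n d k c (placeOnes′ m s))
completions-ones′ n d k c s m ez et with m + len₁ s ≤? len₀ s
... | yes le = trans (completions-ones n d k c s m ez et)
  (cong (λ q → 𝟙 (final n d k c q)) (placeOnes≡placeOnes′ m s le))
... | no nle = trans (completions-ones n d k c s m ez et)
  (trans (𝟙-¬T (λ h → nle (≤-reflexive
  (trans (sym (len₁-placeOnes m s)) (trans (final-len₁ (T-final⇒Final n d k c (placeOnes m s) h)) (sym ez))))))
                  (sym (𝟙-¬T (λ h → nle (≤-reflexive
                    (trans (final-len₁ (T-final⇒Final n d k c (placeOnes′ m s) h)) (sym ez)))))))

completions-ones-two′ : ∀ n d k c j r s → len₀ s ≡ n → len₂ s ≡ 0 → next s + j ≡ c → completions n d k c s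
  (j + suc r) ≡ completions n d k c (place (placeOnes′ j s) 2) r
completions-ones-two′ n d k c j r s ez et ep with j + len₁ s ≤? len₀ s
... | yes le = trans (completions-ones-two n d k c j r s ez et ep)
  (cong (λ q → completions n d k c (place q 2) r) (placeOnes≡placeOnes′ j s le))
... | no nle = trans (completions-ones-two n d k c j r s ez et ep)
  (trans (no-completions-len₁> n d k c (place (placeOnes j s) 2) r
  (subst (n <_) (sym (len₁-placeOnes j s)) (subst (_< j + len₁ s) ez (≰⇒> nle))))
                  (sym (no-completions-len₁> n d k c (place (placeOnes′ j s) 2) r
                    (subst (_< j + len₁ s) ez (≰⇒> nle)))))

-- The suffix starting at the last entry of the first row

𝟙-lastRow≢0 : ∀ p → p ≢ 0 → 𝟙 (p <ᵇ 1) ≡ 0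
𝟙-lastRow≢0 zero h = ⊥-elim (h refl)
𝟙-lastRow≢0 (suc p) h = refl

𝟙-lastRow≡0 : ∀ p → p ≡ 0 → 𝟙 (p <ᵇ 1) ≡ 1
𝟙-lastRow≡0 .zero refl = refl

completions-len₀-mismatch : ∀ n' d k c d'' a c' s M M' → Reachable s → next s ≡ k → a < k → len₀ s ≢ n' →
  completions (suc n') d k c (place s 0) M ≡ completions n' d'' a c' s M'
completions-len₀-mismatch n' d k c d'' a c' s M M' iv ep lt ne =
  trans (completions-at-k-len₀ n' d k c s M ep ne)
    (sym (no-completions-after-k n' d'' a c' s M' (subst (a <_) (sym ep) lt) (λ _ e → ne e)))

no-completions-two-elsewhere : ∀ n d k c s m → len₂ s ≢ 0 → lastOf₂ s ≢ c → completions n d k c s m ≡ 0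
no-completions-two-elsewhere n d k c s m nt nc with len₂ s in et
... | zero = ⊥-elim (nt refl)
... | suc zero = no-completions-two-misplaced n d k c s m et nc
... | suc (suc x) = no-completions-len₂> n d k c s m (subst (1 <_) (sym et) (s≤s (s≤s z≤n)))

suffix-two-term : ∀ n' d' k'' c c' s M M' → Reachable s → next s ≡ suc (suc k'') →
  (∀ dR KR → lastOf₀ s ≡ KR → (∀ x → suc x ≡ suc d' → 𝟙 (lastRow s <ᵇ 1) + x ≡ dR) →
    (∀ x → 𝟙 (lastRow s <ᵇ 1) + x ≡ dR → suc x ≡ suc d') → len₀ s ≡ n' →
     completions (suc n') (suc d') (suc (suc k'')) c (place s 0) M ≡ completions n' dR KR c' s M') →
  completions (suc n') (suc d') (suc (suc k'')) c s (suc M) ≡ completions n' (suc d') (suc k'') c' s M' + sumBelow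
    (suc k'') (λ a → completions n' d' a c' s M')
suffix-two-term n' d' k'' c c' s M M' iv ep body rewrite completions-at-k (suc n') (suc d') (suc (suc k'')) c s M
  iv ep with lastRow s ≟ 0
... | yes e0 rewrite split-after-zero k'' s (completions n' (suc d') (suc k'') c' s M')
  (λ a → completions n' d' a c' s M') iv ep e0
        (λ a lt ne → no-completions-after-k n' d' a c' s M' (subst (a <_) (sym ep) (m<n⇒m<1+n lt)) (λ e' _ → ne e')) = b
  where
  lzk : lastOf₀ s ≡ suc k''
  lzk = suc-injective (trans (lastRow≡0⇒lastOf₀-adjacent iv e0) ep)
  b : completions (suc n') (suc d') (suc (suc k'')) c (place s 0) M ≡ completions n' (suc d') (suc k'') c' s M'
  b with len₀ s ≟ n'
  ... | no ne = completions-len₀-mismatch n' (suc d') (suc (suc k'')) c (suc d') (suc k'') c' s M M' iv ep ≤-refl ne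
  ... | yes ez = body (suc d') (suc k'') lzk (λ x h → trans (cong (_+ x) (𝟙-lastRow≡0 (lastRow s) e0)) h)
    (λ x h → trans (cong (_+ x) (sym (𝟙-lastRow≡0 (lastRow s) e0))) h) ez
... | no n0 rewrite split-after-nonzero k'' s (completions n' (suc d') (suc k'') c' s M')
  (λ a → completions n' d' a c' s M') iv ep n0
        (λ ne → no-completions-after-k n' (suc d') (suc k'') c' s M' (subst (suc k'' <_) (sym ep) ≤-refl)
          (λ e' _ → ne e'))
        (λ a lt ne → no-completions-after-k n' d' a c' s M' (subst (a <_) (sym ep) (m<n⇒m<1+n lt)) (λ e' _ → ne e')) = b
  where
  b : completions (suc n') (suc d') (suc (suc k'')) c (place s 0) M ≡ completions n' d' (lastOf₀ s) c' s M'
  b with len₀ s ≟ n'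
  ... | no ne = completions-len₀-mismatch n' (suc d') (suc (suc k'')) c d' (lastOf₀ s) c' s M M' iv ep
    (subst (lastOf₀ s <_) ep (lastOf₀<next iv)) ne
  ... | yes ez = body d' (lastOf₀ s) refl
    (λ x h → trans (cong (_+ x) (𝟙-lastRow≢0 (lastRow s) n0)) (suc-injective h))
    (λ x h → cong suc (trans (cong (_+ x) (sym (𝟙-lastRow≢0 (lastRow s) n0))) h)) ez

suffix-one-sum : ∀ n' d k c dR c' s M M' → Reachable s → next s ≡ k →
  (len₀ s ≡ n' → completions (suc n') d k c (place s 0) M ≡ completions n' dR (lastOf₀ s) c' s M') →
  completions (suc n') d k c s (suc M) ≡ sumBelow k (λ a → completions n' dR a c' s M')
suffix-one-sum n' d k c dR c' s M M' iv ep body rewrite completions-at-k (suc n') d k c s M iv ep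
  | sumBelow-at-lastOf₀ k s (λ a → completions n' dR a c' s M') iv ep
    (λ a lt ne → no-completions-after-k n' dR a c' s M' (subst (a <_) (sym ep) lt) (λ e' _ → ne e')) with len₀ s ≟ n'
... | no ne = completions-len₀-mismatch n' d k c dR (lastOf₀ s) c' s M M' iv ep
  (subst (lastOf₀ s <_) ep (lastOf₀<next iv)) ne
... | yes ez = body ez

after-k-c<k : ∀ n' d' e k'' c s dR KR → Reachable s → next s ≡ suc (suc k'') → c < suc (suc k'') → lastOf₀ s ≡ KR →
  (∀ x → suc x ≡ suc d' → 𝟙 (lastRow s <ᵇ 1) + x ≡ dR) → (∀ x → 𝟙 (lastRow s <ᵇ 1) + x ≡ dR → suc x ≡ suc d')
    → len₀ s ≡ n' →
  completions (suc n') (suc d') (suc (suc k'')) c (place s 0) (suc (suc e)) ≡ completions n' dR KR c s (suc e)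
after-k-c<k n' d' e k'' c s dR KR iv ep ck lk hd hd' ez with len₂ s ≟ 1 | lastOf₂ s ≟ c
... | yes et | yes ec rewrite completions-ones (suc n') (suc d') (suc (suc k'')) c (place s 0) (suc (suc e))
  (cong suc ez) et
        | completions-ones n' dR KR c s (suc e) ez et
        | placeOnes-suc (suc e) (place s 0) | placeOnes-suc e s = 𝟙-cong to from
  where
  to : T (final (suc n') (suc d') (suc (suc k'')) c (placeOnes-closed (suc e) (place s 0))) → T
    (final n' dR KR c (placeOnes-closed e s))
  to h = let f = T-final⇒Final (suc n') (suc d') (suc (suc k'')) c (placeOnes-closed (suc e) (place s 0)) h in
    Final⇒T-final n' dR KR c (placeOnes-closed e s)
      (mkFinal ez (suc-injective (final-len₁ f)) et (hd (descents s) (final-descents f)) lk ec (final-lattice f))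
  from : T (final n' dR KR c (placeOnes-closed e s)) → T
    (final (suc n') (suc d') (suc (suc k'')) c (placeOnes-closed (suc e) (place s 0)))
  from h = let f = T-final⇒Final n' dR KR c (placeOnes-closed e s) h in
    Final⇒T-final (suc n') (suc d') (suc (suc k'')) c (placeOnes-closed (suc e) (place s 0))
      (mkFinal (cong suc ez) (cong suc (final-len₁ f)) et (hd' (descents s) (final-descents f)) ep ec (final-lattice f))
... | no nt | _ = trans (no-completions-after-c (suc n') (suc d') (suc (suc k'')) c (place s 0) (suc (suc e))
  (subst (c <_) (cong suc (sym ep)) (m<n⇒m<1+n ck)) (λ _ e → nt e))
                     (sym (no-completions-after-c n' dR KR c s (suc e) (subst (c <_) (sym ep) ck) (λ _ e → nt e)))
... | yes _ | no nc = trans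
  (no-completions-after-c (suc n') (suc d') (suc (suc k'')) c (place s 0) (suc (suc e))
  (subst (c <_) (cong suc (sym ep)) (m<n⇒m<1+n ck)) (λ e _ → nc e))
                     (sym (no-completions-after-c n' dR KR c s (suc e) (subst (c <_) (sym ep) ck) (λ e _ → nc e)))

suffix-c<k : ∀ n' d' e k'' c s → Reachable s → next s ≡ suc (suc k'') → c < suc (suc k'') →
  completions (suc n') (suc d') (suc (suc k'')) c s (suc (suc (suc e))) ≡
  completions n' (suc d') (suc k'') c s (suc e) + sumBelow (suc k'') (λ a → completions n' d' a c s (suc e))
suffix-c<k n' d' e k'' c s iv ep ck = suffix-two-term n' d' k'' c c s (suc (suc e)) (suc e) iv ep
  (λ dR KR lk hd hd' ez → after-k-c<k n' d' e k'' c s dR KR iv ep ck lk hd hd' ez)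

+-suc-comm : ∀ p α c' → p + suc α ≡ c' → suc (α + p) ≡ c'
+-suc-comm p α c' ec = trans (cong suc (+-comm α p)) (trans (sym (+-suc p α)) ec)

after-k-k+1<c<2n+1 : ∀ n' d' α β k'' c' s dR KR → Reachable s → next s ≡ suc (suc k'') → next s + suc α ≡ c' →
  lastOf₀ s ≡ KR →
  (∀ x → suc x ≡ suc d' → 𝟙 (lastRow s <ᵇ 1) + x ≡ dR) → (∀ x → 𝟙 (lastRow s <ᵇ 1) + x ≡ dR → suc x ≡ suc d')
    → len₀ s ≡ n' →
  completions (suc n') (suc d') (suc (suc k'')) (suc c') (place s 0) (suc α + suc (suc β)) ≡ completions n' dR KR
    c' s (suc α + suc β)
after-k-k+1<c<2n+1 n' d' α β k'' c' s dR KR iv ep ec lk hd hd' ez with len₂ s ≟ 0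
... | no nt = trans (no-completions-two-elsewhere (suc n') (suc d') (suc (suc k'')) (suc c') (place s 0)
  (suc α + suc (suc β)) nt (λ e → <⇒≢ (m<n⇒m<1+n p2<c') e))
                    (sym (no-completions-two-elsewhere n' dR KR c' s (suc α + suc β) nt (λ e → <⇒≢ p2<c' e)))
  where
  p2<c' : lastOf₂ s < c'
  p2<c' = subst (lastOf₂ s <_) ec (≤-trans (lastOf₂<next iv) (m≤m+n (next s) (suc α)))
... | yes et = trans lhs (trans (𝟙-cong to from) (sym rhs))
  where
  NN = suc n'
  DD = suc d'
  KK = suc (suc k'')
  CC = suc c'
  Ls = placeOnes′ (suc β) (place (placeOnes′ (suc α) (place s 0)) 2)
  Rs = placeOnes′ β (place (placeOnes′ (suc α) s) 2)
  lhs : completions NN DD KK CC (place s 0) (suc α + suc (suc β)) ≡ 𝟙 (final NN DD KK CC Ls)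
  lhs = trans (completions-ones-two′ NN DD KK CC (suc α) (suc β) (place s 0) (cong suc ez) et (cong suc ec))
              (completions-ones′ NN DD KK CC (place (placeOnes′ (suc α) (place s 0)) 2) (suc β)
                (cong suc ez) (cong suc et))
  rhs : completions n' dR KR c' s (suc α + suc β) ≡ 𝟙 (final n' dR KR c' Rs)
  rhs = trans (completions-ones-two′ n' dR KR c' (suc α) β s ez et ec)
              (completions-ones′ n' dR KR c' (place (placeOnes′ (suc α) s) 2) β ez (cong suc et))
  to : T (final NN DD KK CC Ls) → T (final n' dR KR c' Rs)
  to h = let f = T-final⇒Final NN DD KK CC Ls h in
    Final⇒T-final n' dR KR c' Rs (mkFinal ez (suc-injective (final-len₁ f)) (final-len₂ f)
      (trans (cong (_+ suc (𝟙 (lastRow s <ᵇ 1) + descents s)) (descentsOfOnes-after-two β))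
        (trans (sym (+-suc (𝟙 (lastRow s <ᵇ 1)) (descents s))) (hd (suc (descents s)) (final-descents f)))) lk
      (+-suc-comm (next s) α c' ec) (final-lattice f))
  from : T (final n' dR KR c' Rs) → T (final NN DD KK CC Ls)
  from h = let f = T-final⇒Final n' dR KR c' Rs h in
    Final⇒T-final NN DD KK CC Ls (mkFinal (cong suc ez) (cong suc (final-len₁ f)) (final-len₂ f)
      (hd' (suc (descents s)) (trans (+-suc (𝟙 (lastRow s <ᵇ 1)) (descents s))
        (trans (sym (cong (_+ suc (𝟙 (lastRow s <ᵇ 1) + descents s)) (descentsOfOnes-after-two β)))
        (final-descents f)))) ep
      (cong suc (trans (+-suc α (next s)) (+-suc-comm (next s) α c' ec))) (final-lattice f))

suffix-k+1<c<2n+1 : ∀ n' d' α β k'' c' s → Reachable s → next s ≡ suc (suc k'') → next s + suc α ≡ c' →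
  completions (suc n') (suc d') (suc (suc k'')) (suc c') s (suc (suc α + suc (suc β))) ≡
  completions n' (suc d') (suc k'') c' s (suc α + suc β) + sumBelow (suc k'')
    (λ a → completions n' d' a c' s (suc α + suc β))
suffix-k+1<c<2n+1 n' d' α β k'' c' s iv ep ec = suffix-two-term n' d' k'' (suc c') c' s (suc α + suc (suc β))
  (suc α + suc β) iv ep
  (λ dR KR lk hd hd' ez → after-k-k+1<c<2n+1 n' d' α β k'' c' s dR KR iv ep ec lk hd hd' ez)

lattice-no-two : ∀ {b m x y} → m ≡ 0 → T (b ∧ (m <ᵇ suc x)) → T (b ∧ (m <ᵇ suc y))
lattice-no-two refl h = h

after-k-c≡2n+1 : ∀ n' d' γ k'' c' s dR KR → Reachable s → next s ≡ suc (suc k'') → next s + suc γ ≡ c' →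
  lastOf₀ s ≡ KR →
  (∀ x → suc x ≡ suc d' → 𝟙 (lastRow s <ᵇ 1) + x ≡ dR) → (∀ x → 𝟙 (lastRow s <ᵇ 1) + x ≡ dR → suc x ≡ suc d')
    → len₀ s ≡ n' →
  completions (suc n') (suc d') (suc (suc k'')) (suc (suc c')) (place s 0) (suc (suc γ) + 1) ≡ completions n' dR
    KR c' s (suc γ + 1)
after-k-c≡2n+1 n' d' γ k'' c' s dR KR iv ep ec lk hd hd' ez with len₂ s ≟ 0
... | no nt = trans (no-completions-two-elsewhere (suc n') (suc d') (suc (suc k'')) (suc (suc c')) (place s 0)
  (suc (suc γ) + 1) nt (λ e → <⇒≢ (m<n⇒m<1+n (m<n⇒m<1+n p2<c')) e))
                    (sym (no-completions-two-elsewhere n' dR KR c' s (suc γ + 1) nt (λ e → <⇒≢ p2<c' e)))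
  where
  p2<c' : lastOf₂ s < c'
  p2<c' = subst (lastOf₂ s <_) ec (≤-trans (lastOf₂<next iv) (m≤m+n (next s) (suc γ)))
... | yes et = trans lhs (trans (𝟙-cong to from) (sym rhs))
  where
  NN = suc n'
  DD = suc d'
  KK = suc (suc k'')
  CC = suc (suc c')
  Ls = placeOnes′ 0 (place (placeOnes′ (suc (suc γ)) (place s 0)) 2)
  Rs = placeOnes′ 0 (place (placeOnes′ (suc γ) s) 2)
  lhs : completions NN DD KK CC (place s 0) (suc (suc γ) + 1) ≡ 𝟙 (final NN DD KK CC Ls)
  lhs = trans (completions-ones-two′ NN DD KK CC (suc (suc γ)) 0 (place s 0) (cong suc ez) et
    (cong suc (trans (+-suc (next s) (suc γ)) (cong suc ec))))
              (completions-ones′ NN DD KK CC (place (placeOnes′ (suc (suc γ)) (place s 0)) 2) 0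
                (cong suc ez) (cong suc et))
  rhs : completions n' dR KR c' s (suc γ + 1) ≡ 𝟙 (final n' dR KR c' Rs)
  rhs = trans (completions-ones-two′ n' dR KR c' (suc γ) 0 s ez et ec)
              (completions-ones′ n' dR KR c' (place (placeOnes′ (suc γ) s) 2) 0 ez (cong suc et))
  to : T (final NN DD KK CC Ls) → T (final n' dR KR c' Rs)
  to h = let f = T-final⇒Final NN DD KK CC Ls h in
    Final⇒T-final n' dR KR c' Rs (mkFinal ez (suc-injective (final-len₁ f)) (final-len₂ f)
      (trans (sym (+-suc (𝟙 (lastRow s <ᵇ 1)) (descents s))) (hd (suc (descents s)) (final-descents f))) lk
      (+-suc-comm (next s) γ c' ec) (lattice-no-two {lattice s} et (final-lattice f)))
  from : T (final n' dR KR c' Rs) → T (final NN DD KK CC Ls)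
  from h = let f = T-final⇒Final n' dR KR c' Rs h in
    Final⇒T-final NN DD KK CC Ls (mkFinal (cong suc ez) (cong suc (final-len₁ f)) (final-len₂ f)
      (hd' (suc (descents s)) (trans (+-suc (𝟙 (lastRow s <ᵇ 1)) (descents s)) (final-descents f))) ep
      (cong suc (trans (cong suc (+-suc γ (next s))) (cong suc (+-suc-comm (next s) γ c' ec))))
        (lattice-no-two {lattice s} et (final-lattice f)))

suffix-c≡2n+1 : ∀ n' d' γ k'' c' s → Reachable s → next s ≡ suc (suc k'') → next s + suc γ ≡ c' →
  completions (suc n') (suc d') (suc (suc k'')) (suc (suc c')) s (suc (suc (suc γ) + 1)) ≡
  completions n' (suc d') (suc k'') c' s (suc γ + 1) + sumBelow (suc k'') (λ a → completions n' d' a c' s (suc γ + 1))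
suffix-c≡2n+1 n' d' γ k'' c' s iv ep ec = suffix-two-term n' d' k'' (suc (suc c')) c' s (suc (suc γ) + 1)
  (suc γ + 1) iv ep
  (λ dR KR lk hd hd' ez → after-k-c≡2n+1 n' d' γ k'' c' s dR KR iv ep ec lk hd hd' ez)

𝟙-lastRow<2 : ∀ s → Reachable s → 2 ≤ next s → len₂ s ≡ 0 → 𝟙 (lastRow s <ᵇ 2) ≡ 1
𝟙-lastRow<2 s iv le et = 𝟙-T (<⇒<ᵇ (≤∧≢⇒< (lastRow≤2 iv le) (no-two⇒lastRow≢2 iv et)))

suffix-k≡2n : ∀ n' d' k c s → Reachable s → next s ≡ k → completions (suc n') (suc d') k c s 2 ≡ sumBelow k
  (λ a → completions n' d' a c s 0)
suffix-k≡2n n' d' k c s iv ep = suffix-one-sum n' (suc d') k c d' c s 1 0 iv ep body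
  where
  NN = suc n'
  body : len₀ s ≡ n' → completions NN (suc d') k c (place s 0) 1 ≡ completions n' d' (lastOf₀ s) c s 0
  body ez rewrite completions-suc NN (suc d') k c (place s 0) 0
    | no-completions-len₀> NN (suc d') k c (place (place s 0) 0) 0 (subst (λ x → suc x < suc (suc (len₀ s))) ez ≤-refl)
    | no-completions-zero NN (suc d') k c (place (place s 0) 2)
      (λ f → 1+n≰n (≤-trans (≤-reflexive (sym (final-len₁ f)))
      (subst (len₁ s ≤_) ez (lattice⇒len₁≤len₀ iv (T-∧ˡ {lattice s} (final-lattice f))))))
    | completions-zero NN (suc d') k c (place (place s 0) 1) | completions-zero n' d' (lastOf₀ s) c s = trans
      (+-identityʳ _) (𝟙-cong to from)
    where
    S1 = place (place s 0) 1
    to : T (final NN (suc d') k c S1) → T (final n' d' (lastOf₀ s) c s)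
    to h = let f = T-final⇒Final NN (suc d') k c S1 h in Final⇒T-final n' d' (lastOf₀ s) c s
                 (mkFinal ez (suc-injective (final-len₁ f)) (final-len₂ f) (suc-injective (final-descents f)) refl
                 (final-lastOf₂ f) (T-∧ˡ {lattice s} (final-lattice f)))
    from : T (final n' d' (lastOf₀ s) c s) → T (final NN (suc d') k c S1)
    from h = let f = T-final⇒Final n' d' (lastOf₀ s) c s h in Final⇒T-final NN (suc d') k c S1
                   (mkFinal (cong suc ez) (cong suc (final-len₁ f)) (final-len₂ f) (cong suc (final-descents f))
                   ep (final-lastOf₂ f)
      (T-∧⁺ {lattice s} (final-lattice f) (<⇒<ᵇ (s≤s (≤-reflexive (trans (final-len₁ f) (sym ez)))))))

suffix-c≡k+1 : ∀ n' d μ k'' s → Reachable s → next s ≡ suc (suc k'') →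
  completions (suc n') d (suc (suc k'')) (suc (suc (suc k''))) s (suc (suc μ)) ≡ sumBelow (suc (suc k''))
    (λ a → completions n' d a (suc (suc k'')) s μ)
suffix-c≡k+1 n' d μ k'' s iv ep = suffix-one-sum n' d K (suc K) d K s (suc μ) μ iv ep body
  where
  K = suc (suc k'')
  NN = suc n'
  p2≢K : lastOf₂ s ≢ K
  p2≢K e = <⇒≢ (lastOf₂<next iv) (trans e (sym ep))
  body : len₀ s ≡ n' → completions NN d K (suc K) (place s 0) (suc μ) ≡ completions n' d (lastOf₀ s) K s μ
  body ez with len₂ s ≟ 0
  ... | no nt = trans (no-completions-two-elsewhere NN d K (suc K) (place s 0) (suc μ) nt (λ e → p2≢K' e))
                      (sym (no-completions-two-elsewhere n' d (lastOf₀ s) K s μ nt p2≢K))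
    where
    p2≢K' : lastOf₂ s ≢ suc K
    p2≢K' e = <⇒≢ (m<n⇒m<1+n (lastOf₂<next iv)) (trans e (cong suc (sym ep)))
  ... | yes et = trans lhs (rhs μ)
    where
    Ls = placeOnes′ μ (place (placeOnes′ 0 (place s 0)) 2)
    lhs : completions NN d K (suc K) (place s 0) (0 + suc μ) ≡ 𝟙 (final NN d K (suc K) Ls)
    lhs = trans (completions-ones-two′ NN d K (suc K) 0 μ (place s 0) (cong suc ez) et
      (cong suc (trans (+-identityʳ _) ep)))
                (completions-ones′ NN d K (suc K) (place (placeOnes′ 0 (place s 0)) 2) μ (cong suc ez) (cong suc et))
    rhs : ∀ μ' → 𝟙 (final NN d K (suc K) (placeOnes′ μ' (place (placeOnes′ 0 (place s 0)) 2))) ≡ completions n' d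
      (lastOf₀ s) K s μ'
    rhs zero = trans (𝟙-¬T (λ h → let f = T-final⇒Final NN d K (suc K)
                                        (placeOnes′ 0 (place (placeOnes′ 0 (place s 0)) 2)) h in 1+n≰n
                                        (≤-trans (≤-reflexive (sym (final-len₁ f)))
                                        (subst (len₁ s ≤_) ez (lattice⇒len₁≤len₀ iv
                                        (T-∧ˡ {lattice s} {len₂ s <ᵇ len₁ s} (final-lattice f)))))))
                     (sym (no-completions-zero n' d (lastOf₀ s) K s (λ f → p2≢K (final-lastOf₂ f))))
    rhs (suc ν) = trans (𝟙-cong to from) (sym r2)
      where
      Ls' = placeOnes′ (suc ν) (place (placeOnes′ 0 (place s 0)) 2)
      Rs = placeOnes′ ν (place (placeOnes′ 0 s) 2)
      r2 : completions n' d (lastOf₀ s) K s (0 + suc ν) ≡ 𝟙 (final n' d (lastOf₀ s) K Rs)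
      r2 = trans (completions-ones-two′ n' d (lastOf₀ s) K 0 ν s ez et (trans (+-identityʳ _) ep))
                 (completions-ones′ n' d (lastOf₀ s) K (place (placeOnes′ 0 s) 2) ν ez (cong suc et))
      ip : 𝟙 (lastRow s <ᵇ 2) ≡ 1
      ip = 𝟙-lastRow<2 s iv (subst (2 ≤_) (sym ep) (s≤s (s≤s z≤n))) et
      to : T (final NN d K (suc K) Ls') → T (final n' d (lastOf₀ s) K Rs)
      to h = let f = T-final⇒Final NN d K (suc K) Ls' h in Final⇒T-final n' d (lastOf₀ s) K Rs
                   (mkFinal ez (suc-injective (final-len₁ f)) (final-len₂ f)
        (trans (cong₂ _+_ (descentsOfOnes-after-two ν) (cong (_+ descents s) ip)) (final-descents f)) refl ep
          (final-lattice f))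
      from : T (final n' d (lastOf₀ s) K Rs) → T (final NN d K (suc K) Ls')
      from h = let f = T-final⇒Final n' d (lastOf₀ s) K Rs h in Final⇒T-final NN d K (suc K) Ls'
                     (mkFinal (cong suc ez) (cong suc (final-len₁ f)) (final-len₂ f)
        (trans (sym (cong₂ _+_ (descentsOfOnes-after-two ν) (cong (_+ descents s) ip))) (final-descents f)) ep
          (cong suc ep) (final-lattice f))

suffix-k≡2n∸1 : ∀ n'' d' k'' s → Reachable s → next s ≡ suc (suc k'') →
  completions (suc (suc n'')) (suc d') (suc (suc k'')) (suc (suc (suc (suc k'')))) s 3 ≡ sumBelow (suc (suc k''))
    (λ a → completions (suc n'') d' a (suc (suc k'')) s 1)
suffix-k≡2n∸1 n'' d' k'' s iv ep = suffix-one-sum n' (suc d') K C d' K s 2 1 iv ep body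
  where
  n' = suc n''
  K = suc (suc k'')
  C = suc (suc K)
  NN = suc n'
  p2<K : lastOf₂ s < K
  p2<K = subst (lastOf₂ s <_) ep (lastOf₂<next iv)
  body : len₀ s ≡ n' → completions NN (suc d') K C (place s 0) 2 ≡ completions n' d' (lastOf₀ s) K s 1
  body ez with len₂ s ≟ 0
  ... | no nt = trans (no-completions-two-elsewhere NN (suc d') K C (place s 0) 2 nt
    (λ e → <⇒≢ (m<n⇒m<1+n (m<n⇒m<1+n p2<K)) e))
                      (sym (no-completions-two-elsewhere n' d' (lastOf₀ s) K s 1 nt (λ e → <⇒≢ p2<K e)))
  ... | yes et = trans lhs (trans (𝟙-cong to from) (sym rhs))
    where
    Ls = placeOnes′ 0 (place (placeOnes′ 1 (place s 0)) 2)
    Rs = placeOnes′ 0 (place (placeOnes′ 0 s) 2)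
    lhs : completions NN (suc d') K C (place s 0) (1 + 1) ≡ 𝟙 (final NN (suc d') K C Ls)
    lhs = trans (completions-ones-two′ NN (suc d') K C 1 0 (place s 0) (cong suc ez) et
      (cong suc (trans (+-comm (next s) 1) (cong suc ep))))
                (completions-ones′ NN (suc d') K C (place (placeOnes′ 1 (place s 0)) 2) 0 (cong suc ez) (cong suc et))
    rhs : completions n' d' (lastOf₀ s) K s (0 + 1) ≡ 𝟙 (final n' d' (lastOf₀ s) K Rs)
    rhs = trans (completions-ones-two′ n' d' (lastOf₀ s) K 0 0 s ez et (trans (+-identityʳ _) ep))
                (completions-ones′ n' d' (lastOf₀ s) K (place (placeOnes′ 0 s) 2) 0 ez (cong suc et))
    ip : 𝟙 (lastRow s <ᵇ 2) ≡ 1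
    ip = 𝟙-lastRow<2 s iv (subst (2 ≤_) (sym ep) (s≤s (s≤s z≤n))) et
    okc : ∀ {b} x → len₂ s ≡ 0 → T b → T (b ∧ (len₂ s <ᵇ suc x))
    okc {b} x e hb rewrite e = T-∧⁺ {b} hb _
    to : T (final NN (suc d') K C Ls) → T (final n' d' (lastOf₀ s) K Rs)
    to h = let f = T-final⇒Final NN (suc d') K C Ls h in Final⇒T-final n' d' (lastOf₀ s) K Rs
                 (mkFinal ez (suc-injective (final-len₁ f)) (final-len₂ f)
      (trans (cong (_+ descents s) ip) (suc-injective (final-descents f))) refl ep
        (subst (λ x → T (lattice s ∧ (len₂ s <ᵇ x))) (sym (suc-injective (final-len₁ f)))
        (okc n'' et (T-∧ˡ {lattice s} {len₂ s <ᵇ suc (len₁ s)} (final-lattice f)))))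
    from : T (final n' d' (lastOf₀ s) K Rs) → T (final NN (suc d') K C Ls)
    from h = let f = T-final⇒Final n' d' (lastOf₀ s) K Rs h in Final⇒T-final NN (suc d') K C Ls
                   (mkFinal (cong suc ez) (cong suc (final-len₁ f)) (final-len₂ f)
      (cong suc (trans (sym (cong (_+ descents s) ip)) (final-descents f))) ep (cong suc (cong suc ep))
        (okc (len₁ s) et (T-∧ˡ {lattice s} {len₂ s <ᵇ len₁ s} (final-lattice f))))

-- The recurrence

completions-prefix : (H1 H2 : State → ℕ → ℕ) → Stepping H1 → Stepping H2 → ∀ k'' a b →
  (∀ s → Reachable s → next s ≡ suc (suc k'') → H1 s a ≡ H2 s b) → H1 start (suc k'' + a) ≡ H2 start (suc k'' + b)
completions-prefix H1 H2 s1 s2 k'' a b base = stepping-prefix Reachable reachable-place₀ reachable-place₁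
  reachable-place₂ H1 H2 s1 s2 (suc (suc k'')) a b base (suc k'') start reachable-start refl

size-suc : ∀ k'' g n' → suc (suc k'') + g ≡ 2 * suc n' → suc k'' + suc (suc g) ≡ size (suc n')
size-suc k'' g n' h = trans (regroup k'' g) (trans (cong suc h) (twice+1 n'))
  where
  regroup : ∀ k g → suc k + suc (suc g) ≡ suc (suc (suc k) + g)
  regroup = solve-∀
  twice+1 : ∀ n → suc (suc n + (suc n + 0)) ≡ suc n + (suc n + (1 + 0))
  twice+1 = solve-∀

size-pred : ∀ k'' g n' → suc (suc k'') + g ≡ 2 * suc n' → suc k'' + g ≡ size n'
size-pred k'' g n' h = trans (suc-injective (trans h (regroup n'))) (twice+1 n')
  where
  regroup : ∀ n → suc n + (suc n + 0) ≡ suc (n + suc (n + 0))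
  regroup = solve-∀
  twice+1 : ∀ n → n + suc (n + 0) ≡ n + (n + (1 + 0))
  twice+1 = solve-∀

R≡completions-at : ∀ n d k c m → m ≡ size n → R n d k c ≡ completions n d k c start m
R≡completions-at n d k c m e = trans (R≡completions n d k c) (cong (completions n d k c start) (sym e))

sumBelow-R≡completions : ∀ B n d c m → m ≡ size n → sumBelow B (λ a → R n d a c) ≡ sumBelow B
  (λ a → completions n d a c start m)
sumBelow-R≡completions B n d c m e = sumBelow-cong B _ _ (λ a → R≡completions-at n d a c m e)

R-one-sum : ∀ n' d k c dR c' k'' g a b → k ≡ suc (suc k'') → suc (suc k'') + g ≡ 2 * suc n' → a ≡ suc (suc g) → b ≡ g →
  (∀ s → Reachable s → next s ≡ suc (suc k'') → completions (suc n') d k c s a ≡ sumBelow k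
    (λ x → completions n' dR x c' s b)) →
  R (suc n') d k c ≡ sumBelow k (λ x → R n' dR x c')
R-one-sum n' d k c dR c' k'' g a b refl room refl refl base = begin
    R (suc n') d k c
  ≡⟨ R≡completions-at (suc n') d k c _ (size-suc k'' g n' room) ⟩
    completions (suc n') d k c start (suc k'' + suc (suc g))
  ≡⟨ completions-prefix (completions (suc n') d k c) rhs (completions-suc (suc n') d k c) stepping-rhs k'' _ g base ⟩
    sumBelow k (λ x → completions n' dR x c' start (suc k'' + g))
  ≡⟨ sym (sumBelow-R≡completions k n' dR c' _ (size-pred k'' g n' room)) ⟩
    sumBelow k (λ x → R n' dR x c') ∎
  where
  open ≡-Reasoning
  rhs : State → ℕ → ℕ
  rhs s m = sumBelow k (λ x → completions n' dR x c' s m)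
  stepping-rhs : Stepping rhs
  stepping-rhs = stepping-sumBelow k (λ x → completions n' dR x c') (λ x → completions-suc n' dR x c')

R-two-term : ∀ n' d' k c c' k'' g a b → k ≡ suc (suc k'') → suc (suc k'') + g ≡ 2 * suc n' → a ≡ suc (suc g) → b ≡ g →
  (∀ s → Reachable s → next s ≡ suc (suc k'') → completions (suc n') (suc d') k c s a ≡ completions n' (suc d')
    (suc k'') c' s b + sumBelow (suc k'') (λ x → completions n' d' x c' s b)) →
  R (suc n') (suc d') k c ≡ R n' (suc d') (suc k'') c' + sumBelow (suc k'') (λ x → R n' d' x c')
R-two-term n' d' k c c' k'' g a b refl room refl refl base = begin
    R (suc n') (suc d') k c
  ≡⟨ R≡completions-at (suc n') (suc d') k c _ (size-suc k'' g n' room) ⟩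
    completions (suc n') (suc d') k c start (suc k'' + suc (suc g))
  ≡⟨ completions-prefix (completions (suc n') (suc d') k c) rhs (completions-suc (suc n') (suc d') k c)
    stepping-rhs k'' _ g base ⟩
    completions n' (suc d') (suc k'') c' start rest + sumBelow (suc k'') (λ x → completions n' d' x c' start rest)
  ≡⟨ sym (cong₂ _+_ (R≡completions-at n' (suc d') (suc k'') c' _ (size-pred k'' g n' room))
                     (sumBelow-R≡completions (suc k'') n' d' c' _ (size-pred k'' g n' room))) ⟩
    R n' (suc d') (suc k'') c' + sumBelow (suc k'') (λ x → R n' d' x c') ∎
  where
  open ≡-Reasoning
  rest = suc k'' + g
  rhs : State → ℕ → ℕ
  rhs s m = completions n' (suc d') (suc k'') c' s m + sumBelow (suc k'') (λ x → completions n' d' x c' s m)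
  stepping-rhs : Stepping rhs
  stepping-rhs = stepping-+ (completions n' (suc d') (suc k'') c')
    (λ s m → sumBelow (suc k'') (λ x → completions n' d' x c' s m)) (completions-suc n' (suc d') (suc k'') c')
    (stepping-sumBelow (suc k'') (λ x → completions n' d' x c') (λ x → completions-suc n' d' x c'))

module Cases (n'' d'' k'' : ℕ) where
  n' = suc n''
  N = suc n'
  d' = suc d''
  d = suc d'
  K = suc (suc k'')

  2n∸1+1≡2n : 2 * N ∸ 1 + 1 ≡ 2 * N
  2n∸1+1≡2n = trans (+-comm _ 1) (m+[n∸m]≡n {1} {2 * N} (s≤s z≤n))

  R-k≡2n : ∀ c g → K + g ≡ 2 * N → K ≡ 2 * N → R N d K c ≡ sumBelow K (λ a → R n' d' a c)
  R-k≡2n c g room ek = R-one-sum n' d K c d' c k'' g 2 0 refl room (cong (λ x → suc (suc x)) (sym g0)) (sym g0)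
    (λ s iv ep → suffix-k≡2n n' d' K c s iv ep)
    where
    g0 : g ≡ 0
    g0 = +-cancelˡ-≡ K g 0 (trans room (trans (sym ek) (sym (+-identityʳ K))))

  R-c≡k+1 : ∀ g → K + g ≡ 2 * N → R N d K (suc K) ≡ sumBelow K (λ a → R n' d a K)
  R-c≡k+1 g room = R-one-sum n' d K (suc K) d K k'' g (suc (suc g)) g refl room refl refl
    (λ s iv ep → suffix-c≡k+1 n' d g k'' s iv ep)

  R-k≡2n∸1 : ∀ g → K + g ≡ 2 * N → K ≡ 2 * N ∸ 1 → R N d K (suc (suc K)) ≡ sumBelow K (λ a → R n' d' a K)
  R-k≡2n∸1 g room ek = R-one-sum n' d K (suc (suc K)) d' K k'' g 3 1 refl room (cong (λ x → suc (suc x)) (sym g1))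
    (sym g1) (λ s iv ep → suffix-k≡2n∸1 n'' d' k'' s iv ep)
    where
    g1 : g ≡ 1
    g1 = +-cancelˡ-≡ K g 1 (trans room (trans (sym 2n∸1+1≡2n) (cong (_+ 1) (sym ek))))

  R-c≡2n+1 : ∀ γ c' → K + suc (suc γ) ≡ 2 * N → K + suc γ ≡ c' →
    R N d K (suc (suc c')) ≡ R n' d (suc k'') c' + sumBelow (suc k'') (λ a → R n' d' a c')
  R-c≡2n+1 γ c' room ec = R-two-term n' d' K (suc (suc c')) c' k'' (suc (suc γ)) (suc (suc (suc γ) + 1))
    (suc γ + 1) refl room
    (cong suc (+-comm (suc (suc γ)) 1)) (+-comm (suc γ) 1)
      (λ s iv ep → suffix-c≡2n+1 n' d' γ k'' c' s iv ep (trans (cong (_+ suc γ) ep) ec))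

  R-k+1<c<2n+1 : ∀ α β c' → K + (suc α + suc β) ≡ 2 * N → K + suc α ≡ c' →
    R N d K (suc c') ≡ R n' d (suc k'') c' + sumBelow (suc k'') (λ a → R n' d' a c')
  R-k+1<c<2n+1 α β c' room ec = R-two-term n' d' K (suc c') c' k'' (suc α + suc β) (suc (suc α + suc (suc β)))
    (suc α + suc β) refl room
    (cong (λ x → suc (suc x)) (+-suc α (suc β))) refl
      (λ s iv ep → suffix-k+1<c<2n+1 n' d' α β k'' c' s iv ep (trans (cong (_+ suc α) ep) ec))

  R-c<k : ∀ e c → K + suc e ≡ 2 * N → c < K →
    R N d K c ≡ R n' d (suc k'') c + sumBelow (suc k'') (λ a → R n' d' a c)
  R-c<k e c room ck = R-two-term n' d' K c c k'' (suc e) (suc (suc (suc e))) (suc e) refl room refl refl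
    (λ s iv ep → suffix-c<k n' d' e k'' c s iv ep ck)

module TheoremCases (n'' d'' k'' c₀ : ℕ) {g : ℕ} (room : suc (suc k'') + g ≡ 2 * suc (suc n'')) where
  open Cases n'' d'' k''

  C = suc (suc (suc c₀))

  c≡k+2 : K ≡ 2 * N ∸ 1 → C ≡ 2 * N + 1 → c₀ ≡ suc k''
  c≡k+2 ek ec = suc-injective (suc-injective (suc-injective
    (trans ec (trans (cong (_+ 1) (sym (trans (cong (_+ 1) ek) 2n∸1+1≡2n))) (trans (+-assoc K 1 1) (+-comm K 2))))))

  case-k≡2n : K ≡ 2 * N → R N d K C ≡ sumBelow K (λ a → R n' d' a C)
  case-k≡2n = R-k≡2n C g room

  case-c≡k+1 : C ≡ K + 1 → R N d K C ≡ sumBelow K (λ a → R n' d a (suc (suc c₀)))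
  case-c≡k+1 e rewrite suc-injective (suc-injective (suc-injective (trans e (+-comm K 1)))) = R-c≡k+1 g room

  case-k≡2n∸1 : K ≡ 2 * N ∸ 1 → C ≡ 2 * N + 1 → R N d K C ≡ sumBelow K (λ a → R n' d' a (suc c₀))
  case-k≡2n∸1 ek ec rewrite c≡k+2 ek ec = R-k≡2n∸1 g room ek

  case-c≡2n+1 : C ≡ 2 * N + 1 → K ≢ 2 * N ∸ 1 → K ≢ 2 * N →
    R N d K C ≡ R n' d (suc k'') (suc c₀) + sumBelow (suc k'') (λ a → R n' d' a (suc c₀))
  case-c≡2n+1 ec k≢2n∸1 k≢2n = go g room
    where
    go : ∀ g → K + g ≡ 2 * N → R N d K C ≡ R n' d (suc k'') (suc c₀) + sumBelow (suc k'') (λ a → R n' d' a (suc c₀))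
    go zero h = ⊥-elim (k≢2n (trans (sym (+-identityʳ K)) h))
    go (suc zero) h = ⊥-elim (k≢2n∸1 (trans (sym (m+n∸n≡m K 1)) (cong (_∸ 1) h)))
    go (suc (suc γ)) h = R-c≡2n+1 γ (suc c₀) h
      (suc-injective (suc-injective (sym (trans ec (trans (cong (_+ 1) (sym h)) (shift K γ))))))
      where
      shift : ∀ k γ → k + suc (suc γ) + 1 ≡ suc (suc (k + suc γ))
      shift = solve-∀

  case-k+1<c<2n+1 : K + 1 < C → C < 2 * N + 1 →
    R N d K C ≡ R n' d (suc k'') (suc (suc c₀)) + sumBelow (suc k'') (λ a → R n' d' a (suc (suc c₀)))
  case-k+1<c<2n+1 k+1<c c<2n+1 = R-k+1<c<2n+1 α β (suc (suc c₀)) room′ (suc-injective (trans (cong suc (+-suc K α)) hα))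
    where
    k+2≤c : suc (suc K) ≤ C
    k+2≤c = subst (λ x → suc x ≤ C) (+-comm K 1) k+1<c
    α = proj₁ (m≤n⇒∃[o]m+o≡n k+2≤c)
    hα : suc (suc K) + α ≡ C
    hα = proj₂ (m≤n⇒∃[o]m+o≡n k+2≤c)
    shift : ∀ k a → suc (suc k) + a ≡ k + suc (suc a)
    shift = solve-∀
    α+2≤g : suc (suc α) ≤ g
    α+2≤g = +-cancelˡ-≤ K _ _
      (subst₂ _≤_ (trans (sym hα) (shift K α)) (sym room) (≤-pred (subst (suc C ≤_) (+-comm (2 * N) 1) c<2n+1)))
    β = proj₁ (m≤n⇒∃[o]m+o≡n α+2≤g)
    room′ : K + (suc α + suc β) ≡ 2 * N
    room′ = trans (cong (K +_) (trans (+-suc (suc α) β) (proj₂ (m≤n⇒∃[o]m+o≡n α+2≤g)))) room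

  case-c<k : C < K → K < 2 * N → R N d K C ≡ R n' d (suc k'') C + sumBelow (suc k'') (λ a → R n' d' a C)
  case-c<k c<k k<2n = go g room
    where
    go : ∀ g → K + g ≡ 2 * N → R N d K C ≡ R n' d (suc k'') C + sumBelow (suc k'') (λ a → R n' d' a C)
    go zero h = ⊥-elim (<-irrefl (trans (sym (+-identityʳ K)) h) k<2n)
    go (suc e) h = R-c<k e C h c<k

mainTheorem8 : R 1 2 1 3 ≡ 1
    × (∀ n d k c → 2 ≤ n → n ≤ k → k ≤ 2 * n → 3 ≤ c → c ≤ 2 * n + 1 → c ≢ k → 2 ≤ d → d ≤ n + 1 →
    (k ≡ 2 * n →
    R n d k c ≡ sumBelow k (λ a → R (n ∸ 1) (d ∸ 1) a c))
    × (c ≡ k + 1 →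
    R n d k c ≡ sumBelow k (λ a → R (n ∸ 1) d a (c ∸ 1)))
    × (k ≡ 2 * n ∸ 1 → c ≡ 2 * n + 1 →
    R n d k c ≡ sumBelow k (λ a → R (n ∸ 1) (d ∸ 1) a (c ∸ 2)))
    × (c ≡ 2 * n + 1 → k ≢ 2 * n ∸ 1 → k ≢ 2 * n →
    R n d k c ≡ R (n ∸ 1) d (k ∸ 1) (c ∸ 2) + sumBelow (k ∸ 1) (λ a → R (n ∸ 1) (d ∸ 1) a (c ∸ 2)))
    × (k + 1 < c → c < 2 * n + 1 →
    R n d k c ≡ R (n ∸ 1) d (k ∸ 1) (c ∸ 1) + sumBelow (k ∸ 1) (λ a → R (n ∸ 1) (d ∸ 1) a (c ∸ 1)))
    × (c < k → k < 2 * n →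
    R n d k c ≡ R (n ∸ 1) d (k ∸ 1) c + sumBelow (k ∸ 1) (λ a → R (n ∸ 1) (d ∸ 1) a c)))
mainTheorem8 = refl , λ where
  (suc (suc n'')) (suc (suc d'')) (suc (suc k'')) (suc (suc (suc c₀))) (s≤s (s≤s z≤n)) (s≤s (s≤s _)) k≤2n
    (s≤s (s≤s (s≤s z≤n))) _ _ (s≤s (s≤s z≤n)) _ →
    let open TheoremCases n'' d'' k'' c₀ (proj₂ (m≤n⇒∃[o]m+o≡n k≤2n))
    in case-k≡2n , case-c≡k+1 , case-k≡2n∸1 , case-c≡2n+1 , case-k+1<c<2n+1 , case-c<k
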